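{- For every $n\ge1$, $$\sum_{K\in Sp_{2n}(\mathbb{Z}_2)}(-1)^{o(K)}=-2^{n^2}\,[2]_2[4]_2\cdots[2n-2]_2,$$ where $o(K)$ is the number of entries equal to $1$ in $K$.
   Context: Let $J$ be the $n\times n$ matrix with $1$'s on the antidiagonal and $0$ elsewhere, and $M=\begin{pmatrix}0&J\\-J&0\end{pmatrix}$. Then $Sp_{2n}(\mathbb{F})=\{A\in SL_{2n}(\mathbb{F}): A^TMA=M\}$; here $\mathbb{F}=\mathbb{Z}_2$ is the field with two elements. For $m\ge1$, $[m]_2=1+2+\cdots+2^{m-1}=2^m-1$; an empty product equals $1$. -}

module Defs where

open import Data.Bool using (Bool; true; false; _∧_; _xor_; if_then_else_)
open import Data.Nat as ℕ using (ℕ; zero; suc; _∸_)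
open import Data.Integer as ℤ using (ℤ; +_; -_)
open import Data.Fin using (Fin; zero; suc; splitAt; opposite; punchIn)
open import Data.Fin.Properties using (all?) renaming (_≟_ to _≟F_)
open import Data.Bool.Properties using () renaming (_≟_ to _≟B_)
open import Data.List using (List; []; _∷_; map; foldr; concatMap; filter; allFin)
open import Data.Sum using (inj₁; inj₂)
open import Data.Product using (_×_)
open import Relation.Nullary using (Dec; does; _×-dec_)
open import Relation.Binary.PropositionalEquality using (_≡_)

-- The field Z₂ is modelled by Bool: addition = xor, multiplication = ∧.
-- Square matrices over Z₂ of size m, as functions.
Mat : ℕ → Set
Mat m = Fin m → Fin m → Bool

sumZ2 : List Bool → Bool
sumZ2 = foldr _xor_ false

transpose : ∀ {m} → Mat m → Mat m
transpose A i j = A j i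

_·_ : ∀ {m} → Mat m → Mat m → Mat m
(A · B) i k = sumZ2 (map (λ j → A i j ∧ B j k) (allFin _))

-- Determinant over Z₂ by Laplace expansion along the first row
-- (signs are irrelevant in characteristic 2).
det : ∀ {m} → Mat m → Bool
det {zero}  A = true
det {suc m} A = sumZ2 (map (λ j → A zero j ∧ det {m} (λ r c → A (suc r) (punchIn j c))) (allFin (suc m)))

Jmat : ∀ n → Mat n
Jmat n a b = does (b ≟F opposite a)

Mmat : ∀ n → Mat (n ℕ.+ n)
Mmat n i j with splitAt n i | splitAt n j
... | inj₁ a | inj₂ b = Jmat n a b
... | inj₂ a | inj₁ b = Jmat n a b   -- entry of -J, equal to J since -1 = 1 in Z₂
... | inj₁ _ | inj₁ _ = false
... | inj₂ _ | inj₂ _ = false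

IsSymplectic : ∀ n → Mat (n ℕ.+ n) → Set
IsSymplectic n A = (det A ≡ true) × (∀ i j → (transpose A · (Mmat n · A)) i j ≡ Mmat n i j)

isSymplectic? : ∀ n (A : Mat (n ℕ.+ n)) → Dec (IsSymplectic n A)
isSymplectic? n A = (det A ≟B true) ×-dec
  all? (λ i → all? (λ j → (transpose A · (Mmat n · A)) i j ≟B Mmat n i j))

allFuns : ∀ {a} {A : Set a} (k : ℕ) → List A → List (Fin k → A)
allFuns zero    xs = (λ ()) ∷ []
allFuns (suc k) xs = concatMap (λ x → map (λ f → λ { zero → x ; (suc i) → f i }) (allFuns k xs)) xs

allMats : ∀ m → List (Mat m)
allMats m = allFuns m (allFuns m (false ∷ true ∷ []))

Sp : ∀ n → List (Mat (n ℕ.+ n))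
Sp n = filter (isSymplectic? n) (allMats (n ℕ.+ n))

countTrue : ∀ {k} → (Fin k → Bool) → ℕ
countTrue {k} v = foldr (λ i acc → if v i then suc acc else acc) 0 (allFin k)

o : ∀ {m} → Mat m → ℕ
o {m} K = foldr (λ i acc → countTrue (K i) ℕ.+ acc) 0 (allFin m)

sumℤ : List ℤ → ℤ
sumℤ = foldr ℤ._+_ (+ 0)

bracket2 : ℕ → ℕ
bracket2 m = 2 ℕ.^ m ∸ 1

bracketProd : ℕ → ℕ
bracketProd zero    = 1
bracketProd (suc k) = bracketProd k ℕ.* bracket2 (2 ℕ.* suc k)

{-# OPTIONS --safe #-}
-- Since o(K) ≡ Σᵢⱼ Kᵢⱼ (mod 2), the summand is s(K𝟙) with s(v) = (−1)^(Σₐ vₐ). Symplectic transvections act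
-- transitively on nonzero vectors, so for any fixed u ≠ 0 every v ≠ 0 equals Ku for the same number
-- |Sp| / (2^2n − 1) of K ∈ Sp. As Σ_{v ≠ 0} s(v) = −1, the sum is −|Sp| / (2^2n − 1). For u = e₀ that number
-- is the order of the stabiliser of e₀, whose elements are block matrices built from a bit, a vector of
-- 𝔽₂^(2n−2) and an element of Sp_(2n−2); so it is 2^(2n−1) |Sp_(2n−2)|, and induction gives
-- |Sp_2n| = 2^(n²) [2]₂ [4]₂ ⋯ [2n]₂. The determinant condition in Sp is automatic: det is multiplicative
-- (via the sign-free Leibniz formula over 𝔽₂) and det M = 1.
module Submission where

open import Defs
open import Data.Nat using (ℕ; _≥_; _∸_; _^_; _*_)
open import Data.Integer using (ℤ; +_; -_) renaming (_^_ to _^ℤ_)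
open import Data.List using (map)
open import Relation.Binary.PropositionalEquality using (_≡_)

open import Algebra.Bundles using (AbelianGroup; CommutativeMonoid; CommutativeSemiring; CommutativeRing)
open import Algebra.Core using (Op₂)
open import Algebra.Structures using (IsCommutativeSemiring)
open import Data.Bool using (Bool; true; false; if_then_else_; _∧_; not; _xor_)
open import Data.Bool.Properties as Boolₚ
  using (xor-assoc; xor-identityʳ; xor-same; ∧-comm; ∧-zeroʳ; ∧-identityʳ; ∧-distribˡ-xor; ∧-distribʳ-xor;
         not-involutive; not-injective; ¬-not)
open import Data.Empty using (⊥-elim)
open import Data.Fin using (Fin; zero; suc; _↑ˡ_; _↑ʳ_; punchIn; punchOut; splitAt; join; opposite; inject₁; fromℕ)
open import Data.Fin.Permutation using (Permutation′; permutation; _⟨$⟩ʳ_; _⟨$⟩ˡ_; inverseˡ; inverseʳ)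
import Data.Fin.Permutation as Permutation
import Data.Fin.Permutation.Components as Components
open import Data.Fin.Properties
  using (_≟_; _<?_; <-cmp; <-asym; all?; any?; ¬∀⟶∃¬; suc-injective; 0≢1+n; punchInᵢ≢i; punchIn-injective;
         punchIn-punchOut; punchOut-injective; injective⇒≤; splitAt-↑ˡ; splitAt-↑ʳ; splitAt⁻¹-↑ˡ; splitAt⁻¹-↑ʳ;
         join-splitAt; opposite-involutive; ↑ˡ-injective; ↑ʳ-injective)
import Data.Fin.Relation.Unary.Top as Top
import Data.Integer as ℤ
import Data.Integer.Properties as ℤₚ
open import Data.List using (List; []; _∷_; _++_; concat; concatMap; allFin; tabulate; foldr; filter)
open import Data.List.Properties using (map-tabulate)
import Data.Nat as ℕ
open import Data.Nat using (zero; suc; _+_)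
import Data.Nat.Properties as ℕₚ
open import Data.Nat.Tactic.RingSolver using (solve-∀)
open import Data.Product using (∃; _×_; _,_; proj₁; proj₂)
open import Data.Product.Relation.Binary.Pointwise.NonDependent
  using (×-isDecEquivalence) renaming (Pointwise to ×-Pointwise)
open import Data.Sum using (_⊎_; inj₁; inj₂; [_,_]′)
open import Data.Vec.Functional as Vector using (Vector; tail) renaming (_∷_ to _∷ᵥ_)
open import Data.Vec.Functional.Relation.Binary.Pointwise using (Pointwise)
import Data.Vec.Functional.Relation.Binary.Pointwise.Properties as Pointwise
open import Function using (_∘_; _⇔_; mk⇔; Equivalence)
open import Function.Definitions using (Congruent; Injective)
open import Level using (0ℓ)
open import Relation.Binary.Core using (Rel)
open import Relation.Binary.Definitions using (Decidable; DecidableEquality; tri<; tri≈; tri>)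
open import Relation.Binary.PropositionalEquality
  using (refl; sym; trans; cong; cong₂; subst; subst₂; _≗_; _≢_)
import Relation.Binary.PropositionalEquality as ≡
open import Relation.Binary.Structures using (IsDecEquivalence)
open import Relation.Nullary using (Dec; yes; no; ¬_; does; _×-dec_; _→-dec_; map′)
open import Relation.Nullary.Decidable using (dec-true; dec-false; does-⇔; decidable-stable)

open import Algebra.Properties.CommutativeSemigroup (CommutativeMonoid.commutativeSemigroup Boolₚ.∧-commutativeMonoid)
  using () renaming (x∙yz≈y∙xz to ∧-x∙yz≈y∙xz; x∙yz≈yx∙z to ∧-x∙yz≈yx∙z; x∙yz≈z∙xy to ∧-x∙yz≈z∙xy;
                     xy∙z≈zx∙y to ∧-xy∙z≈zx∙y)
open import Algebra.Properties.CommutativeMonoid.Sum Boolₚ.∧-commutativeMonoid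
  using () renaming (sum-permute to ∧-sum-permute; ∑-distrib-+ to ∧-∑-distrib-+)
open CommutativeRing Boolₚ.xor-∧-commutativeRing
  using () renaming (semiring to 𝔽₂-semiring; isCommutativeSemiring to 𝔽₂-isCommutativeSemiring)
open import Algebra.Properties.Semiring.Sum 𝔽₂-semiring
  using (sum; sum-syntax; sum-cong-≗; *-distribˡ-sum; *-distribʳ-sum; sum-permute; sum-replicate-zero; sum-init-last)
  renaming (∑-distrib-+ to sum-distrib-xor; ∑-comm to sum-comm)
open import Algebra.Properties.Group (AbelianGroup.group ℤₚ.+-0-abelianGroup)
  using () renaming (∙-cancelˡ to ℤ+-cancelˡ)

dec-true⁻¹ : ∀ {P : Set} (P? : Dec P) → does P? ≡ true → P
dec-true⁻¹ (yes p) _ = p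

dec-false⁻¹ : ∀ {P : Set} (P? : Dec P) → does P? ≡ false → ¬ P
dec-false⁻¹ (no ¬p) _ = ¬p

xor≡false⇒≡ : ∀ {a b} → a xor b ≡ false → a ≡ b
xor≡false⇒≡ {false} {false} _ = refl
xor≡false⇒≡ {true}  {true}  _ = refl

∧≡true⇒ˡ : ∀ {a b} → a ∧ b ≡ true → a ≡ true
∧≡true⇒ˡ {true} _ = refl

∧≡true⇒ʳ : ∀ {a b} → a ∧ b ≡ true → b ≡ true
∧≡true⇒ʳ {true} b≡t = b≡t

-- Finite sums over enumerated setoids

countᵇ : {A : Set} → (A → Bool) → List A → ℕ
countᵇ p []       = 0
countᵇ p (x ∷ xs) = if p x then suc (countᵇ p xs) else countᵇ p xs

-- Vectors and matrices are functions, equal only pointwise, so finite types are enumerated as setoids.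
record Enumeration (A : Set) : Set₁ where
  field
    _≈_              : Rel A 0ℓ
    isDecEquivalence : IsDecEquivalence _≈_
    elements         : List A

  open IsDecEquivalence isDecEquivalence public
    using (reflexive) renaming (sym to ≈-sym; trans to ≈-trans; _≟_ to _≈?_)

  infix 5 _≈ᵇ_
  _≈ᵇ_ : A → A → Bool
  x ≈ᵇ y = does (x ≈? y)

  field
    occurs-once : ∀ z → countᵇ (_≈ᵇ z) elements ≡ 1

  ≈ᵇ-sym : ∀ x y → x ≈ᵇ y ≡ y ≈ᵇ x
  ≈ᵇ-sym x y = does-⇔ (mk⇔ ≈-sym ≈-sym) (x ≈? y) (y ≈? x)

  ≈ᵇ-cong : ∀ {x x′ y y′} → x ≈ x′ → y ≈ y′ → x ≈ᵇ y ≡ x′ ≈ᵇ y′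
  ≈ᵇ-cong x≈x′ y≈y′ = does-⇔
    (mk⇔ (λ x≈y → ≈-trans (≈-sym x≈x′) (≈-trans x≈y y≈y′))
         (λ x′≈y′ → ≈-trans x≈x′ (≈-trans x′≈y′ (≈-sym y≈y′))))
    (_ ≈? _) (_ ≈? _)

module ListSum {R : Set} {_+_ _*_ : Op₂ R} {0# 1# : R}
  (isCommutativeSemiring : IsCommutativeSemiring _≡_ _+_ _*_ 0# 1#) where

  private
    semiring : CommutativeSemiring 0ℓ 0ℓ
    semiring = record { isCommutativeSemiring = isCommutativeSemiring }

  open CommutativeSemiring semiring
    using (+-assoc; +-identityˡ; +-identityʳ; *-comm; *-identityˡ; distribˡ; zeroˡ; zeroʳ; +-commutativeSemigroup)
  open import Algebra.Properties.CommutativeSemigroup +-commutativeSemigroup using (interchange)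

  ∑ : {A : Set} → List A → (A → R) → R
  ∑ []       F = 0#
  ∑ (x ∷ xs) F = F x + ∑ xs F

  when : Bool → R → R
  when b r = if b then r else 0#

  when-0# : ∀ b → when b 0# ≡ 0#
  when-0# false = refl
  when-0# true  = refl

  when-1#* : ∀ b r → when b 1# * r ≡ when b r
  when-1#* false r = zeroˡ r
  when-1#* true  r = *-identityˡ r

  when-when : ∀ a b r → when a (when b r) ≡ when (b ∧ a) r
  when-when false false r = refl
  when-when false true  r = refl
  when-when true  false r = refl
  when-when true  true  r = refl

  ∑-cong : ∀ {A} (xs : List A) {F G : A → R} → F ≗ G → ∑ xs F ≡ ∑ xs G
  ∑-cong []       F≗G = refl
  ∑-cong (x ∷ xs) F≗G = cong₂ _+_ (F≗G x) (∑-cong xs F≗G)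

  ∑-zero : ∀ {A} (xs : List A) {F : A → R} → (∀ x → F x ≡ 0#) → ∑ xs F ≡ 0#
  ∑-zero []       F≡0 = refl
  ∑-zero (x ∷ xs) F≡0 = trans (cong₂ _+_ (F≡0 x) (∑-zero xs F≡0)) (+-identityˡ 0#)

  ∑-distrib-+ : ∀ {A} (xs : List A) (F G : A → R) → ∑ xs (λ x → F x + G x) ≡ ∑ xs F + ∑ xs G
  ∑-distrib-+ []       F G = sym (+-identityˡ 0#)
  ∑-distrib-+ (x ∷ xs) F G =
    trans (cong (_+_ (F x + G x)) (∑-distrib-+ xs F G)) (interchange (F x) (G x) _ _)

  *-distribˡ-∑ : ∀ {A} c (xs : List A) (F : A → R) → c * ∑ xs F ≡ ∑ xs (λ x → c * F x)
  *-distribˡ-∑ c []       F = zeroʳ c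
  *-distribˡ-∑ c (x ∷ xs) F = trans (distribˡ c (F x) (∑ xs F)) (cong (_+_ (c * F x)) (*-distribˡ-∑ c xs F))

  *-distribʳ-∑ : ∀ {A} c (xs : List A) (F : A → R) → ∑ xs F * c ≡ ∑ xs (λ x → F x * c)
  *-distribʳ-∑ c xs F = trans (*-comm _ c) (trans (*-distribˡ-∑ c xs F) (∑-cong xs (λ x → *-comm c (F x))))

  ∑-++ : ∀ {A} (xs ys : List A) (F : A → R) → ∑ (xs ++ ys) F ≡ ∑ xs F + ∑ ys F
  ∑-++ []       ys F = sym (+-identityˡ _)
  ∑-++ (x ∷ xs) ys F = trans (cong (_+_ (F x)) (∑-++ xs ys F)) (sym (+-assoc _ _ _))

  ∑-map : ∀ {A B} (f : A → B) (xs : List A) (F : B → R) → ∑ (map f xs) F ≡ ∑ xs (F ∘ f)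
  ∑-map f []       F = refl
  ∑-map f (x ∷ xs) F = cong (_+_ (F (f x))) (∑-map f xs F)

  ∑-concat : ∀ {A} (xss : List (List A)) (F : A → R) → ∑ (concat xss) F ≡ ∑ xss (λ xs → ∑ xs F)
  ∑-concat []         F = refl
  ∑-concat (xs ∷ xss) F = trans (∑-++ xs (concat xss) F) (cong (_+_ (∑ xs F)) (∑-concat xss F))

  ∑-concatMap : ∀ {A B} (g : A → List B) (xs : List A) (F : B → R) →
    ∑ (concatMap g xs) F ≡ ∑ xs (λ x → ∑ (g x) F)
  ∑-concatMap g xs F = trans (∑-concat (map g xs) F) (∑-map g xs _)

  ∑-comm : ∀ {A B} (xs : List A) (ys : List B) (H : A → B → R) →
    ∑ xs (λ x → ∑ ys (H x)) ≡ ∑ ys (λ y → ∑ xs (λ x → H x y))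
  ∑-comm []       ys H = sym (∑-zero ys (λ _ → refl))
  ∑-comm (x ∷ xs) ys H =
    trans (cong (_+_ (∑ ys (H x))) (∑-comm xs ys H)) (sym (∑-distrib-+ ys (H x) _))

  ∑-const : ∀ {A} (xs : List A) r → ∑ xs (λ _ → r) ≡ ∑ xs (λ _ → 1#) * r
  ∑-const xs r = trans (∑-cong xs (λ _ → sym (*-identityˡ r))) (sym (*-distribʳ-∑ r xs (λ _ → 1#)))

  ∑-pairs : ∀ {A B} (xs : List A) (ys : List B) (F : A × B → R) →
    ∑ (concatMap (λ a → map (a ,_) ys) xs) F ≡ ∑ xs (λ a → ∑ ys (λ b → F (a , b)))
  ∑-pairs xs ys F = trans (∑-concatMap _ xs F) (∑-cong xs (λ a → ∑-map (a ,_) ys F))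

  ∑-allFuns-suc : ∀ {B} m (bs : List B) (F : (Fin (suc m) → B) → R) → (∀ {f g} → f ≗ g → F f ≡ F g) →
    ∑ (allFuns (suc m) bs) F ≡ ∑ bs (λ b → ∑ (allFuns m bs) (λ h → F (b ∷ᵥ h)))
  ∑-allFuns-suc m bs F F-ext = trans (∑-concatMap _ bs F) (∑-cong bs (λ b →
    trans (∑-map _ (allFuns m bs) F) (∑-cong (allFuns m bs) (λ h → F-ext λ { zero → refl ; (suc i) → refl }))))

  ∏ : ∀ {m} → Vector R m → R
  ∏ = Vector.foldr _*_ 1#

  ∏-cong : ∀ {m} {F G : Vector R m} → F ≗ G → ∏ F ≡ ∏ G
  ∏-cong {zero}  F≗G = refl
  ∏-cong {suc m} F≗G = cong₂ _*_ (F≗G zero) (∏-cong (F≗G ∘ suc))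

  ∏-∑-allFuns : ∀ {B} m (bs : List B) (H : Fin m → B → R) →
    ∏ (λ i → ∑ bs (H i)) ≡ ∑ (allFuns m bs) (λ g → ∏ (λ i → H i (g i)))
  ∏-∑-allFuns zero    bs H = sym (+-identityʳ 1#)
  ∏-∑-allFuns (suc m) bs H = begin
    ∑ bs (H zero) * ∏ (λ i → ∑ bs (H (suc i)))
      ≡⟨ cong (∑ bs (H zero) *_) (∏-∑-allFuns m bs (H ∘ suc)) ⟩
    ∑ bs (H zero) * ∑ (allFuns m bs) (λ g → ∏ (λ i → H (suc i) (g i)))
      ≡⟨ *-distribʳ-∑ _ bs (H zero) ⟩
    ∑ bs (λ b → H zero b * ∑ (allFuns m bs) (λ g → ∏ (λ i → H (suc i) (g i))))
      ≡⟨ ∑-cong bs (λ b → *-distribˡ-∑ (H zero b) (allFuns m bs) _) ⟩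
    ∑ bs (λ b → ∑ (allFuns m bs) (λ g → H zero b * ∏ (λ i → H (suc i) (g i))))
      ≡⟨ ∑-allFuns-suc m bs _ (λ f≗g → ∏-cong (λ i → cong (H i) (f≗g i))) ⟨
    ∑ (allFuns (suc m) bs) (λ g → ∏ (λ i → H i (g i))) ∎
    where open ≡.≡-Reasoning

  ∑-when-countᵇ≡0 : ∀ {A} (p : A → Bool) (xs : List A) (F : A → R) →
    countᵇ p xs ≡ 0 → ∑ xs (λ x → when (p x) (F x)) ≡ 0#
  ∑-when-countᵇ≡0 p []       F _ = refl
  ∑-when-countᵇ≡0 p (x ∷ xs) F c≡0 with p x
  ... | false = trans (+-identityˡ _) (∑-when-countᵇ≡0 p xs F c≡0)

  ∑-when-countᵇ≡1 : ∀ {A} (p : A → Bool) (xs : List A) (F : A → R) {c} →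
    countᵇ p xs ≡ 1 → (∀ x → p x ≡ true → F x ≡ c) → ∑ xs (λ x → when (p x) (F x)) ≡ c
  ∑-when-countᵇ≡1 p (x ∷ xs) F c≡1 F≡c with p x in px
  ... | true  = trans (cong₂ _+_ (F≡c x px) (∑-when-countᵇ≡0 p xs F (ℕₚ.suc-injective c≡1))) (+-identityʳ _)
  ... | false = trans (+-identityˡ _) (∑-when-countᵇ≡1 p xs F c≡1 F≡c)

  module _ {A : Set} (E : Enumeration A) where
    open Enumeration E

    ∑-select : ∀ z (F : A → R) → (∀ {x} → x ≈ z → F x ≡ F z) →
      ∑ elements (λ x → when (x ≈ᵇ z) (F x)) ≡ F z
    ∑-select z F F-resp =
      ∑-when-countᵇ≡1 (_≈ᵇ z) elements F (occurs-once z) (λ x x≈ᵇz → F-resp (dec-true⁻¹ (x ≈? z) x≈ᵇz))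

  module _ {X Y : Set} (EX : Enumeration X) (EY : Enumeration Y) where
    private
      module X = Enumeration EX
      module Y = Enumeration EY

    ∑-reindex : (ψ : Y → X) {F : X → R} → Congruent X._≈_ _≡_ F →
      Congruent Y._≈_ X._≈_ ψ → Injective Y._≈_ X._≈_ ψ → (∀ x → F x ≡ 0# ⊎ ∃ λ y → ψ y X.≈ x) →
      ∑ Y.elements (F ∘ ψ) ≡ ∑ X.elements F
    ∑-reindex ψ {F} F-cong ψ-cong ψ-injective covers = begin
      ∑ Y.elements (F ∘ ψ)
        ≡⟨ ∑-cong Y.elements (λ y → sym (∑-select EX (ψ y) F F-cong)) ⟩
      ∑ Y.elements (λ y → ∑ X.elements (λ x → when (x X.≈ᵇ ψ y) (F x)))
        ≡⟨ ∑-comm Y.elements X.elements _ ⟩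
      ∑ X.elements (λ x → ∑ Y.elements (λ y → when (x X.≈ᵇ ψ y) (F x)))
        ≡⟨ ∑-cong X.elements fibre ⟩
      ∑ X.elements F ∎
      where
      open ≡.≡-Reasoning
      fibre : ∀ x → ∑ Y.elements (λ y → when (x X.≈ᵇ ψ y) (F x)) ≡ F x
      fibre x with covers x
      ... | inj₁ Fx≡0 = trans (∑-zero Y.elements λ y → trans (cong (when _) Fx≡0) (when-0# (x X.≈ᵇ ψ y))) (sym Fx≡0)
      ... | inj₂ (y₀ , ψy₀≈x) = trans (∑-cong Y.elements (λ y → cong (λ b → when b (F x)) (same y)))
                                      (∑-select EY y₀ (λ _ → F x) (λ _ → refl))
        where
        same : ∀ y → x X.≈ᵇ ψ y ≡ y Y.≈ᵇ y₀
        same y = does-⇔ (mk⇔ (λ x≈ψy → ψ-injective (X.≈-trans (X.≈-sym x≈ψy) (X.≈-sym ψy₀≈x)))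
                              (λ y≈y₀ → X.≈-trans (X.≈-sym ψy₀≈x) (ψ-cong (Y.≈-sym y≈y₀))))
                        (x X.≈? ψ y) (y Y.≈? y₀)

  ∑-involution : ∀ {A} (E : Enumeration A) (φ : A → A) {F : A → R} → let open Enumeration E in
    Congruent _≈_ _≡_ F → Congruent _≈_ _≈_ φ → (∀ x → φ (φ x) ≈ x) → ∑ elements (F ∘ φ) ≡ ∑ elements F
  ∑-involution E φ F-cong φ-cong φφ≈id = ∑-reindex E E φ F-cong φ-cong
    (λ {x} {y} φx≈φy → ≈-trans (≈-sym (φφ≈id x)) (≈-trans (φ-cong φx≈φy) (φφ≈id y)))
    (λ x → inj₂ (φ x , φφ≈id x))
    where open Enumeration E

module ℕΣ = ListSum ℕₚ.+-*-isCommutativeSemiring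

countᵇ≡∑ : ∀ {A : Set} (p : A → Bool) (xs : List A) → countᵇ p xs ≡ ℕΣ.∑ xs (λ x → ℕΣ.when (p x) 1)
countᵇ≡∑ p []       = refl
countᵇ≡∑ p (x ∷ xs) with p x
... | true  = cong suc (countᵇ≡∑ p xs)
... | false = countᵇ≡∑ p xs

countᵇ-map : ∀ {A B : Set} (p : B → Bool) (f : A → B) (xs : List A) → countᵇ p (map f xs) ≡ countᵇ (p ∘ f) xs
countᵇ-map p f []       = refl
countᵇ-map p f (x ∷ xs) with p (f x)
... | true  = cong suc (countᵇ-map p f xs)
... | false = countᵇ-map p f xs

countᵇ-none : ∀ {A : Set} (p : A → Bool) (xs : List A) → (∀ x → p x ≡ false) → countᵇ p xs ≡ 0
countᵇ-none p []       _   = refl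
countᵇ-none p (x ∷ xs) p≡f rewrite p≡f x = countᵇ-none p xs p≡f

∑-∑-when-∧ : ∀ {A B : Set} (p : A → Bool) (q : B → Bool) (xs : List A) (ys : List B) →
  ℕΣ.∑ xs (λ x → ℕΣ.∑ ys (λ y → ℕΣ.when (p x ∧ q y) 1)) ≡ countᵇ p xs * countᵇ q ys
∑-∑-when-∧ p q []       ys = refl
∑-∑-when-∧ p q (x ∷ xs) ys with p x
... | true  = cong₂ _+_ (sym (countᵇ≡∑ q ys)) (∑-∑-when-∧ p q xs ys)
... | false = cong₂ _+_ (ℕΣ.∑-zero ys (λ _ → refl)) (∑-∑-when-∧ p q xs ys)

≡-enumeration : ∀ {A : Set} (_≟′_ : DecidableEquality A) (xs : List A) →
  (∀ z → countᵇ (λ x → does (x ≟′ z)) xs ≡ 1) → Enumeration A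
≡-enumeration _≟′_ xs occurs-once = record
  { _≈_ = _≡_ ; isDecEquivalence = ≡.isDecEquivalence _≟′_ ; elements = xs ; occurs-once = occurs-once }

Bool-enumeration : Enumeration Bool
Bool-enumeration = ≡-enumeration Boolₚ._≟_ (false ∷ true ∷ []) λ { false → refl ; true → refl }

countᵇ-tabulate-suc : ∀ m (p : Fin (suc m) → Bool) →
  countᵇ p (tabulate suc) ≡ countᵇ (p ∘ suc) (allFin m)
countᵇ-tabulate-suc m p = trans (cong (countᵇ p) (sym (map-tabulate (λ i → i) suc))) (countᵇ-map p suc (allFin m))

allFin-occurs-once : ∀ m (z : Fin m) → countᵇ (λ x → does (x ≟ z)) (allFin m) ≡ 1
allFin-occurs-once (suc m) zero     =
  cong suc (trans (countᵇ-tabulate-suc m _) (countᵇ-none _ (allFin m) (λ _ → refl)))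
allFin-occurs-once (suc m) (suc z′) = trans (countᵇ-tabulate-suc m _) (allFin-occurs-once m z′)

Fin-enumeration : ∀ m → Enumeration (Fin m)
Fin-enumeration m = ≡-enumeration _≟_ (allFin m) (allFin-occurs-once m)

→-enumeration : ∀ {A : Set} k → Enumeration A → Enumeration (Vector A k)
→-enumeration {A} k E = record
  { _≈_              = Pointwise E._≈_
  ; isDecEquivalence = Pointwise.isDecEquivalence E.isDecEquivalence k
  ; elements         = allFuns k E.elements
  ; occurs-once      = allFuns-occurs-once k
  }
  where
  module E = Enumeration E
  open ≡.≡-Reasoning

  _≋?_ : ∀ {k} → Decidable (Pointwise E._≈_ {k})
  _≋?_ = Pointwise.decidable E._≈?_

  ≋ᵇ-cons : ∀ {k} x (h : Vector A k) z → does ((x ∷ᵥ h) ≋? z) ≡ (x E.≈ᵇ z zero) ∧ does (h ≋? tail z)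
  ≋ᵇ-cons x h z = does-⇔ (mk⇔ (λ p → p zero , p ∘ suc) (λ { (p , q) zero → p ; (p , q) (suc i) → q i }))
    ((x ∷ᵥ h) ≋? z) ((x E.≈? z zero) ×-dec (h ≋? tail z))

  ≋ᵇ-ext : ∀ {k} {f g : Vector A k} z → f ≗ g → does (f ≋? z) ≡ does (g ≋? z)
  ≋ᵇ-ext z f≗g = does-⇔ (mk⇔ (λ p i → E.≈-trans (E.reflexive (sym (f≗g i))) (p i))
                              (λ p i → E.≈-trans (E.reflexive (f≗g i)) (p i)))
    (_ ≋? z) (_ ≋? z)

  allFuns-occurs-once : ∀ k (z : Vector A k) → countᵇ (λ f → does (f ≋? z)) (allFuns k E.elements) ≡ 1
  allFuns-occurs-once zero    z = cong (λ b → if b then 1 else 0) (dec-true ((λ ()) ≋? z) (λ ()))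
  allFuns-occurs-once (suc k) z = begin
    countᵇ (λ f → does (f ≋? z)) (allFuns (suc k) E.elements)
      ≡⟨ countᵇ≡∑ _ (allFuns (suc k) E.elements) ⟩
    ℕΣ.∑ (allFuns (suc k) E.elements) (λ f → ℕΣ.when (does (f ≋? z)) 1)
      ≡⟨ ℕΣ.∑-allFuns-suc k E.elements _ (λ f≗g → cong (λ b → ℕΣ.when b 1) (≋ᵇ-ext z f≗g)) ⟩
    ℕΣ.∑ E.elements (λ x → ℕΣ.∑ (allFuns k E.elements) (λ h → ℕΣ.when (does ((x ∷ᵥ h) ≋? z)) 1))
      ≡⟨ ℕΣ.∑-cong E.elements (λ x → ℕΣ.∑-cong (allFuns k E.elements) (λ h →
           cong (λ b → ℕΣ.when b 1) (≋ᵇ-cons x h z))) ⟩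
    ℕΣ.∑ E.elements (λ x → ℕΣ.∑ (allFuns k E.elements) (λ h →
      ℕΣ.when ((x E.≈ᵇ z zero) ∧ does (h ≋? tail z)) 1))
      ≡⟨ ∑-∑-when-∧ _ _ E.elements (allFuns k E.elements) ⟩
    countᵇ (E._≈ᵇ z zero) E.elements * countᵇ (λ h → does (h ≋? tail z)) (allFuns k E.elements)
      ≡⟨ cong₂ _*_ (E.occurs-once (z zero)) (allFuns-occurs-once k (tail z)) ⟩
    1 ∎

×-enumeration : ∀ {A B : Set} → Enumeration A → Enumeration B → Enumeration (A × B)
×-enumeration {A} {B} EA EB = record
  { _≈_              = ×-Pointwise EA._≈_ EB._≈_
  ; isDecEquivalence = ×-isDecEquivalence EA.isDecEquivalence EB.isDecEquivalence
  ; elements         = pairs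
  ; occurs-once      = pairs-occurs-once
  }
  where
  module EA = Enumeration EA
  module EB = Enumeration EB
  open ≡.≡-Reasoning

  pairs : List (A × B)
  pairs = concatMap (λ a → map (a ,_) EB.elements) EA.elements

  pairs-occurs-once : ∀ z → countᵇ (λ p → (proj₁ p EA.≈ᵇ proj₁ z) ∧ (proj₂ p EB.≈ᵇ proj₂ z)) pairs ≡ 1
  pairs-occurs-once (a₀ , b₀) = begin
    countᵇ _ pairs
      ≡⟨ countᵇ≡∑ _ pairs ⟩
    ℕΣ.∑ pairs _
      ≡⟨ ℕΣ.∑-concatMap _ EA.elements _ ⟩
    ℕΣ.∑ EA.elements (λ a → ℕΣ.∑ (map (a ,_) EB.elements) _)
      ≡⟨ ℕΣ.∑-cong EA.elements (λ a → ℕΣ.∑-map (a ,_) EB.elements _) ⟩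
    ℕΣ.∑ EA.elements (λ a → ℕΣ.∑ EB.elements (λ b → ℕΣ.when ((a EA.≈ᵇ a₀) ∧ (b EB.≈ᵇ b₀)) 1))
      ≡⟨ ∑-∑-when-∧ _ _ EA.elements EB.elements ⟩
    countᵇ (EA._≈ᵇ a₀) EA.elements * countᵇ (EB._≈ᵇ b₀) EB.elements
      ≡⟨ cong₂ _*_ (EA.occurs-once a₀) (EB.occurs-once b₀) ⟩
    1 ∎

module ℤΣ = ListSum ℤₚ.+-*-isCommutativeSemiring

∑-vectors-const : ∀ k c → ℤΣ.∑ (allFuns k (false ∷ true ∷ [])) (λ _ → c) ≡ + (2 ^ k) ℤ.* c
∑-vectors-const zero    c = trans (ℤₚ.+-identityʳ c) (sym (ℤₚ.*-identityˡ c))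
∑-vectors-const (suc k) c = begin
  ℤΣ.∑ (allFuns (suc k) (false ∷ true ∷ [])) (λ _ → c)
    ≡⟨ ℤΣ.∑-allFuns-suc k (false ∷ true ∷ []) (λ _ → c) (λ _ → refl) ⟩
  ℤΣ.∑ (false ∷ true ∷ []) (λ _ → ℤΣ.∑ (allFuns k (false ∷ true ∷ [])) (λ _ → c))
    ≡⟨ ℤΣ.∑-const (false ∷ true ∷ []) _ ⟩
  + 2 ℤ.* ℤΣ.∑ (allFuns k (false ∷ true ∷ [])) (λ _ → c)
    ≡⟨ cong (+ 2 ℤ.*_) (∑-vectors-const k c) ⟩
  + 2 ℤ.* (+ (2 ^ k) ℤ.* c)
    ≡⟨ ℤₚ.*-assoc (+ 2) (+ (2 ^ k)) c ⟨
  (+ 2 ℤ.* + (2 ^ k)) ℤ.* c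
    ≡⟨ cong (ℤ._* c) (ℤₚ.pos-* 2 (2 ^ k)) ⟨
  + (2 ^ suc k) ℤ.* c ∎
  where open ≡.≡-Reasoning

-- Sums and products over 𝔽₂

module 𝔽₂Σ = ListSum 𝔽₂-isCommutativeSemiring

sumZ2≡∑ : ∀ {A : Set} (xs : List A) (F : A → Bool) → sumZ2 (map F xs) ≡ 𝔽₂Σ.∑ xs F
sumZ2≡∑ []       F = refl
sumZ2≡∑ (x ∷ xs) F = cong (F x xor_) (sumZ2≡∑ xs F)

∑-tabulate : ∀ {A : Set} m (g : Fin m → A) (F : A → Bool) → 𝔽₂Σ.∑ (tabulate g) F ≡ ∑[ i < m ] F (g i)
∑-tabulate zero    g F = refl
∑-tabulate (suc m) g F = cong (F (g zero) xor_) (∑-tabulate m (g ∘ suc) F)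

sumZ2-allFin : ∀ {m} (F : Vector Bool m) → sumZ2 (map F (allFin m)) ≡ sum F
sumZ2-allFin {m} F = trans (sumZ2≡∑ (allFin m) F) (∑-tabulate m (λ i → i) F)

sum-zero : ∀ {m} {F : Vector Bool m} → (∀ i → F i ≡ false) → sum F ≡ false
sum-zero {m} F≡0 = trans (sum-cong-≗ F≡0) (sum-replicate-zero m)

sum-↑ : ∀ m {n} (F : Vector Bool (m + n)) → sum F ≡ (∑[ i < m ] F (i ↑ˡ n)) xor (∑[ j < n ] F (m ↑ʳ j))
sum-↑ zero    F = refl
sum-↑ (suc m) F = trans (cong (F zero xor_) (sum-↑ m (F ∘ suc))) (sym (xor-assoc (F zero) _ _))

sum-select : ∀ {m} (z : Fin m) (F : Vector Bool m) → ∑[ i < m ] (does (i ≟ z) ∧ F i) ≡ F z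
sum-select {suc m} zero F = trans (cong (F zero xor_) (sum-zero {m} (λ _ → refl))) (xor-identityʳ (F zero))
sum-select {suc m} (suc z) F = sum-select z (F ∘ suc)

∏-true⇔ : ∀ {m} (F : Vector Bool m) → 𝔽₂Σ.∏ F ≡ true ⇔ (∀ i → F i ≡ true)
∏-true⇔ {zero}  F = mk⇔ (λ _ ()) (λ _ → refl)
∏-true⇔ {suc m} F with F zero in F₀
... | true  = mk⇔ (λ ∏≡t → λ { zero → F₀ ; (suc i) → Equivalence.to (∏-true⇔ (F ∘ suc)) ∏≡t i })
                  (λ all → Equivalence.from (∏-true⇔ (F ∘ suc)) (all ∘ suc))
... | false = mk⇔ (λ ()) (λ all → trans (sym F₀) (all zero))

∏-does : ∀ {m} {P : Fin m → Set} (P? : ∀ i → Dec (P i)) → 𝔽₂Σ.∏ (λ i → does (P? i)) ≡ does (all? P?)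
∏-does P? with all? P?
... | yes ∀P = trans (Equivalence.from (∏-true⇔ _) (λ i → dec-true (P? i) (∀P i))) (sym (dec-true (all? P?) ∀P))
... | no ¬∀P = trans (¬-not (λ ∏≡t → ¬∀P (λ i → dec-true⁻¹ (P? i) (Equivalence.to (∏-true⇔ _) ∏≡t i))))
                     (sym (dec-false (all? P?) ¬∀P))

∏-permute : ∀ {m} (π : Permutation′ m) (F : Vector Bool m) → 𝔽₂Σ.∏ F ≡ 𝔽₂Σ.∏ (F ∘ (π ⟨$⟩ʳ_))
∏-permute π F = ∧-sum-permute F π

-- In characteristic 2 a sum vanishes when φ pairs off its support; P selects one member of each pair.
∑-cancel-pairs : ∀ {A : Set} (E : Enumeration A) (φ : A → A) (P : A → Bool) {F : A → Bool} →
  let open Enumeration E in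
  Congruent _≈_ _≡_ F → Congruent _≈_ _≡_ P → Congruent _≈_ _≈_ φ → (∀ x → φ (φ x) ≈ x) →
  (∀ x → F (φ x) ≡ F x) → (∀ x → F x ≡ true → P (φ x) ≡ not (P x)) → 𝔽₂Σ.∑ elements F ≡ false
∑-cancel-pairs E φ P {F} F-cong P-cong φ-cong φφ≈id Fφ≡F Pφ≡¬P = begin
  𝔽₂Σ.∑ elements F
    ≡⟨ 𝔽₂Σ.∑-cong elements split ⟩
  𝔽₂Σ.∑ elements (λ x → (P x ∧ F x) xor (not (P x) ∧ F x))
    ≡⟨ 𝔽₂Σ.∑-distrib-+ elements _ _ ⟩
  𝔽₂Σ.∑ elements (λ x → P x ∧ F x) xor 𝔽₂Σ.∑ elements (λ x → not (P x) ∧ F x)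
    ≡⟨ cong (𝔽₂Σ.∑ elements (λ x → P x ∧ F x) xor_) (begin
        𝔽₂Σ.∑ elements (λ x → not (P x) ∧ F x)
          ≡⟨ 𝔽₂Σ.∑-involution E φ (λ x≈y → cong₂ (λ p f → not p ∧ f) (P-cong x≈y) (F-cong x≈y)) φ-cong φφ≈id ⟨
        𝔽₂Σ.∑ elements (λ x → not (P (φ x)) ∧ F (φ x))
          ≡⟨ 𝔽₂Σ.∑-cong elements swapped ⟩
        𝔽₂Σ.∑ elements (λ x → P x ∧ F x) ∎) ⟩
  𝔽₂Σ.∑ elements (λ x → P x ∧ F x) xor 𝔽₂Σ.∑ elements (λ x → P x ∧ F x)
    ≡⟨ xor-same (𝔽₂Σ.∑ elements (λ x → P x ∧ F x)) ⟩
  false ∎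
  where
  open Enumeration E
  open ≡.≡-Reasoning
  split : ∀ x → F x ≡ (P x ∧ F x) xor (not (P x) ∧ F x)
  split x with P x
  ... | true  = sym (xor-identityʳ (F x))
  ... | false = refl
  swapped : ∀ x → not (P (φ x)) ∧ F (φ x) ≡ P x ∧ F x
  swapped x rewrite Fφ≡F x with F x in Fx
  ... | false = trans (∧-zeroʳ _) (sym (∧-zeroʳ _))
  ... | true  = trans (cong (λ b → not b ∧ true) (Pφ≡¬P x Fx)) (cong (_∧ true) (not-involutive (P x)))

-- Maps between finite sets

injective? : ∀ {m k} (f : Fin m → Fin k) → Dec (Injective _≡_ _≡_ f)
injective? f = map′ (λ inj {i} {j} → inj i j) (λ inj i j → inj)
  (all? λ i → all? λ j → (f i ≟ f j) →-dec (i ≟ j))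

injective?-⇔ : ∀ {m k m′ k′} (f : Fin m → Fin k) (g : Fin m′ → Fin k′) →
  (Injective _≡_ _≡_ f → Injective _≡_ _≡_ g) → (Injective _≡_ _≡_ g → Injective _≡_ _≡_ f) →
  does (injective? f) ≡ does (injective? g)
injective?-⇔ f g f⇒g g⇒f = does-⇔ (mk⇔ f⇒g g⇒f) (injective? f) (injective? g)

injective?-cong : ∀ {m k} {f g : Fin m → Fin k} → f ≗ g → does (injective? f) ≡ does (injective? g)
injective?-cong {f = f} {g} f≗g = injective?-⇔ f g
  (λ inj eq → inj (trans (f≗g _) (trans eq (sym (f≗g _)))))
  (λ inj eq → inj (trans (sym (f≗g _)) (trans eq (f≗g _))))

injective⇒does-≟ : ∀ {m k} (f : Fin m → Fin k) → Injective _≡_ _≡_ f → ∀ a b → does (f a ≟ f b) ≡ does (a ≟ b)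
injective⇒does-≟ f f-inj a b = does-⇔ (mk⇔ f-inj (cong f)) (f a ≟ f b) (a ≟ b)

Fun-enumeration : ∀ m k → Enumeration (Fin m → Fin k)
Fun-enumeration m k = →-enumeration m (Fin-enumeration k)

injective⇒surjective : ∀ {m} (g : Fin m → Fin m) → Injective _≡_ _≡_ g → ∀ y → ∃ λ x → g x ≡ y
injective⇒surjective {suc k} g g-inj y with any? (λ x → g x ≟ y)
... | yes found   = found
... | no  missing = ⊥-elim (ℕₚ.n≮n k (injective⇒≤ squeezed-injective))
  where
  y≢g : ∀ x → y ≢ g x
  y≢g x y≡gx = missing (x , sym y≡gx)
  squeezed : Fin (suc k) → Fin k
  squeezed x = punchOut (y≢g x)
  squeezed-injective : Injective _≡_ _≡_ squeezed
  squeezed-injective {x} {x′} eq = g-inj (punchOut-injective (y≢g x) (y≢g x′) eq)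

injective⇒permutation : ∀ {m} (g : Fin m → Fin m) → Injective _≡_ _≡_ g → Permutation′ m
injective⇒permutation g g-inj = permutation g (proj₁ ∘ surj) (proj₂ ∘ surj) (λ x → g-inj (proj₂ (surj (g x))))
  where surj = injective⇒surjective g g-inj

¬injective⇒collision : ∀ {m k} (g : Fin m → Fin k) → ¬ Injective _≡_ _≡_ g → ∃ λ i → ∃ λ i′ → i ≢ i′ × g i ≡ g i′
¬injective⇒collision g ¬inj = i , i′ , (λ i≡i′ → ¬injective-at-i′ (λ _ → i≡i′)) ,
  decidable-stable (g i ≟ g i′) (λ gi≢gi′ → ¬injective-at-i′ (λ gi≡gi′ → ⊥-elim (gi≢gi′ gi≡gi′)))
  where
  ¬injective-at : ∃ λ i → ¬ ∀ i′ → g i ≡ g i′ → i ≡ i′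
  ¬injective-at = ¬∀⟶∃¬ _ _ (λ i → all? (λ i′ → (g i ≟ g i′) →-dec (i ≟ i′))) (λ inj → ¬inj (λ {i} {i′} → inj i i′))
  i = proj₁ ¬injective-at
  i′ = proj₁ (¬∀⟶∃¬ _ _ (λ i′ → (g i ≟ g i′) →-dec (i ≟ i′)) (proj₂ ¬injective-at))
  ¬injective-at-i′ : ¬ (g i ≡ g i′ → i ≡ i′)
  ¬injective-at-i′ = proj₂ (¬∀⟶∃¬ _ _ (λ i′ → (g i ≟ g i′) →-dec (i ≟ i′)) (proj₂ ¬injective-at))

transpose-matchˡ : ∀ {m} (i j : Fin m) → Components.transpose i j i ≡ j
transpose-matchˡ i j rewrite dec-true (i ≟ i) refl = refl

transpose-matchʳ : ∀ {m} (i j : Fin m) → Components.transpose i j j ≡ i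
transpose-matchʳ i j with j ≟ i
... | yes j≡i = j≡i
... | no  _   rewrite dec-true (j ≟ j) refl = refl

transpose-involutive : ∀ {m} (i j : Fin m) {k} → Components.transpose i j (Components.transpose i j k) ≡ k
transpose-involutive i j {k} =
  trans (cong (Components.transpose i j) (transpose-comm k)) (Components.transpose-inverse i j)
  where
  transpose-comm : ∀ k → Components.transpose i j k ≡ Components.transpose j i k
  transpose-comm k with k ≟ i | k ≟ j
  ... | yes k≡i | yes k≡j = trans (sym k≡j) k≡i
  ... | yes k≡i | no  _   rewrite dec-true (k ≟ i) k≡i = refl
  ... | no  _   | yes k≡j rewrite dec-true (k ≟ j) k≡j = refl
  ... | no  k≢i | no  k≢j rewrite dec-false (k ≟ i) k≢i | dec-false (k ≟ j) k≢j = refl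

transpose-fixes : ∀ {m} {B : Set} (g : Fin m → B) {i j} → g i ≡ g j → g ∘ Components.transpose i j ≗ g
transpose-fixes g {i} {j} gi≡gj k with k ≟ i
... | yes k≡i = trans (sym gi≡gj) (cong g (sym k≡i))
... | no  _ with k ≟ j
...   | yes k≡j = trans gi≡gj (cong g (sym k≡j))
...   | no  _   = refl

<-flip : ∀ {m} {a b : Fin m} → a ≢ b → does (b <? a) ≡ not (does (a <? b))
<-flip {a = a} {b} a≢b with <-cmp a b
... | tri< a<b _ _ = trans (dec-false (b <? a) (<-asym a<b)) (cong not (sym (dec-true (a <? b) a<b)))
... | tri≈ _ a≡b _ = ⊥-elim (a≢b a≡b)
... | tri> _ _ b<a = trans (dec-true (b <? a) b<a) (cong not (sym (dec-false (a <? b) (<-asym b<a))))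

↑-induction : ∀ {m n} {P : Fin (m + n) → Set} → (∀ a → P (a ↑ˡ n)) → (∀ b → P (m ↑ʳ b)) → ∀ k → P k
↑-induction {m} {n} {P} left right k = subst P (join-splitAt m n k) (by-cases (splitAt m k))
  where
  by-cases : ∀ s → P (join m n s)
  by-cases (inj₁ a) = left a
  by-cases (inj₂ b) = right b

↑ˡ≢↑ʳ : ∀ {n} (a b : Fin n) → a ↑ˡ n ≢ n ↑ʳ b
↑ˡ≢↑ʳ {n} a b eq with () ← trans (sym (splitAt-↑ˡ n a n)) (trans (cong (splitAt n) eq) (splitAt-↑ʳ n n b))

opposite-fromℕ : ∀ m → opposite (fromℕ m) ≡ zero
opposite-fromℕ zero    = refl
opposite-fromℕ (suc m) = cong inject₁ (opposite-fromℕ m)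

opposite-inject₁ : ∀ {m} (j : Fin m) → opposite (inject₁ j) ≡ suc (opposite j)
opposite-inject₁ {suc m} zero    = refl
opposite-inject₁ {suc m} (suc j) = cong inject₁ (opposite-inject₁ j)

-- Determinants over 𝔽₂

-- Over 𝔽₂ the signs of the Leibniz formula disappear.
leibniz : ∀ {m} → Mat m → Bool
leibniz {m} A = 𝔽₂Σ.∑ (allFuns m (allFin m)) (λ f → does (injective? f) ∧ 𝔽₂Σ.∏ (λ i → A i (f i)))

leibniz-cong : ∀ {m} {A B : Mat m} → (∀ i j → A i j ≡ B i j) → leibniz A ≡ leibniz B
leibniz-cong {m} A≡B =
  𝔽₂Σ.∑-cong (allFuns m (allFin m)) (λ f → cong (does (injective? f) ∧_) (𝔽₂Σ.∏-cong (λ i → A≡B i (f i))))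

module LaplaceExpansion {m} (A : Mat (suc m)) (j : Fin (suc m)) where

  minor : Mat m
  minor r c = A (suc r) (punchIn j c)

  punchIn∘ : (Fin m → Fin m) → Fin m → Fin (suc m)
  punchIn∘ g r = punchIn j (g r)

  term : (Fin m → Fin (suc m)) → Bool
  term h = does (injective? (j ∷ᵥ h)) ∧ (A zero j ∧ 𝔽₂Σ.∏ (λ r → A (suc r) (h r)))

  injective-cons-punchIn : ∀ g → does (injective? (j ∷ᵥ punchIn∘ g)) ≡ does (injective? g)
  injective-cons-punchIn g = injective?-⇔ (j ∷ᵥ punchIn∘ g) g
    (λ inj gr≡gs → suc-injective (inj (cong (punchIn j) gr≡gs)))
    (λ inj → λ { {zero} {zero} _ → refl
               ; {zero} {suc s} j≡ → ⊥-elim (punchInᵢ≢i j (g s) (sym j≡))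
               ; {suc r} {zero} ≡j → ⊥-elim (punchInᵢ≢i j (g r) ≡j)
               ; {suc r} {suc s} eq → cong suc (inj (punchIn-injective j (g r) (g s) eq)) })

  covers : ∀ h → term h ≡ false ⊎ ∃ λ g → Pointwise _≡_ (punchIn∘ g) h
  covers h with injective? (j ∷ᵥ h)
  ... | no ¬inj = inj₁ (cong (_∧ (A zero j ∧ 𝔽₂Σ.∏ (λ r → A (suc r) (h r)))) (dec-false (injective? (j ∷ᵥ h)) ¬inj))
  ... | yes inj = inj₂ ((λ r → punchOut (j≢h r)) , λ r → punchIn-punchOut (j≢h r))
    where
    j≢h : ∀ r → j ≢ h r
    j≢h r j≡hr = 0≢1+n (inj {zero} {suc r} j≡hr)

  expand : A zero j ∧ leibniz minor ≡ 𝔽₂Σ.∑ (allFuns m (allFin (suc m))) term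
  expand = begin
    A zero j ∧ leibniz minor
      ≡⟨ 𝔽₂Σ.*-distribˡ-∑ (A zero j) (allFuns m (allFin m)) _ ⟩
    𝔽₂Σ.∑ (allFuns m (allFin m)) (λ g → A zero j ∧ (does (injective? g) ∧ 𝔽₂Σ.∏ (λ r → minor r (g r))))
      ≡⟨ 𝔽₂Σ.∑-cong (allFuns m (allFin m)) (λ g →
           trans (∧-x∙yz≈y∙xz (A zero j) (does (injective? g)) (𝔽₂Σ.∏ (λ r → minor r (g r))))
                 (cong (_∧ (A zero j ∧ 𝔽₂Σ.∏ (λ r → minor r (g r)))) (sym (injective-cons-punchIn g)))) ⟩
    𝔽₂Σ.∑ (allFuns m (allFin m)) (term ∘ punchIn∘)
      ≡⟨ 𝔽₂Σ.∑-reindex (Fun-enumeration m (suc m)) (Fun-enumeration m m) punchIn∘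
           (λ {h} {h′} h≈h′ → cong₂ _∧_ (injective?-cong {f = j ∷ᵥ h} {j ∷ᵥ h′} λ { zero → refl ; (suc r) → h≈h′ r })
                               (cong (A zero j ∧_) (𝔽₂Σ.∏-cong (λ r → cong (A (suc r)) (h≈h′ r)))))
           (λ g≈g′ r → cong (punchIn j) (g≈g′ r))
           (λ ψg≈ψg′ r → punchIn-injective j _ _ (ψg≈ψg′ r))
           covers ⟩
    𝔽₂Σ.∑ (allFuns m (allFin (suc m))) term ∎
    where open ≡.≡-Reasoning

det≡leibniz : ∀ {m} (A : Mat m) → det A ≡ leibniz A
det≡leibniz {zero}  A = refl
det≡leibniz {suc m} A = begin
  det A
    ≡⟨ sumZ2≡∑ (allFin (suc m)) (λ j → A zero j ∧ det (minor j)) ⟩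
  𝔽₂Σ.∑ (allFin (suc m)) (λ j → A zero j ∧ det (minor j))
    ≡⟨ 𝔽₂Σ.∑-cong (allFin (suc m)) (λ j → cong (A zero j ∧_) (det≡leibniz (minor j))) ⟩
  𝔽₂Σ.∑ (allFin (suc m)) (λ j → A zero j ∧ leibniz (minor j))
    ≡⟨ 𝔽₂Σ.∑-cong (allFin (suc m)) expand ⟩
  𝔽₂Σ.∑ (allFin (suc m)) (λ j → 𝔽₂Σ.∑ (allFuns m (allFin (suc m))) (term j))
    ≡⟨ 𝔽₂Σ.∑-allFuns-suc m (allFin (suc m)) _
         (λ f≗g → cong₂ _∧_ (injective?-cong f≗g) (𝔽₂Σ.∏-cong (λ i → cong (A i) (f≗g i)))) ⟨
  leibniz A ∎
  where
  open ≡.≡-Reasoning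
  open LaplaceExpansion A

leibniz-permuteRows : ∀ {m} (B : Mat m) (π : Permutation′ m) → leibniz (λ i → B (π ⟨$⟩ʳ i)) ≡ leibniz B
leibniz-permuteRows {m} B π = trans
  (𝔽₂Σ.∑-cong (allFuns m (allFin m)) term-unpermute)
  (𝔽₂Σ.∑-reindex (Fun-enumeration m m) (Fun-enumeration m m) (λ f → f ∘ π⁻¹) term-cong
    (λ f≈f′ i → f≈f′ (π⁻¹ i))
    (λ {f} {f′} fπ⁻¹≈f′π⁻¹ i →
       trans (cong f (sym (inverseˡ π))) (trans (fπ⁻¹≈f′π⁻¹ (π ⟨$⟩ʳ i)) (cong f′ (inverseˡ π))))
    (λ f → inj₂ (f ∘ (π ⟨$⟩ʳ_) , λ i → cong f (inverseʳ π))))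
  where
  π⁻¹ : Fin m → Fin m
  π⁻¹ = π ⟨$⟩ˡ_
  term : Mat m → (Fin m → Fin m) → Bool
  term A f = does (injective? f) ∧ 𝔽₂Σ.∏ (λ i → A i (f i))
  term-cong : ∀ {f f′} → Pointwise _≡_ f f′ → term B f ≡ term B f′
  term-cong f≈f′ = cong₂ _∧_ (injective?-cong f≈f′) (𝔽₂Σ.∏-cong (λ i → cong (B i) (f≈f′ i)))
  term-unpermute : ∀ f → term (λ i → B (π ⟨$⟩ʳ i)) f ≡ term B (f ∘ π⁻¹)
  term-unpermute f = cong₂ _∧_
    (injective?-⇔ f (f ∘ π⁻¹)
      (λ inj eq → trans (sym (inverseʳ π)) (trans (cong (π ⟨$⟩ʳ_) (inj eq)) (inverseʳ π)))
      (λ inj eq → trans (sym (inverseˡ π))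
                    (trans (cong π⁻¹ (inj (trans (cong f (inverseˡ π)) (trans eq (cong f (sym (inverseˡ π)))))))
                           (inverseˡ π))))
    (trans (𝔽₂Σ.∏-cong (λ i → cong (B (π ⟨$⟩ʳ i)) (cong f (sym (inverseˡ π)))))
           (sym (∏-permute π (λ i → B i (f (π⁻¹ i))))))

-- Swapping the two equal rows pairs off the terms.
leibniz-equalRows : ∀ {m} (A : Mat m) {i i′} → i ≢ i′ → A i ≗ A i′ → leibniz A ≡ false
leibniz-equalRows {m} A {i} {i′} i≢i′ Ai≗Ai′ =
  ∑-cancel-pairs (Fun-enumeration m m) (λ f → f ∘ τ) (λ f → does (f i <? f i′))
    (λ f≈f′ → cong₂ _∧_ (injective?-cong f≈f′) (𝔽₂Σ.∏-cong (λ k → cong (A k) (f≈f′ k))))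
    (λ f≈f′ → cong₂ (λ a b → does (a <? b)) (f≈f′ i) (f≈f′ i′))
    (λ f≈f′ k → f≈f′ (τ k))
    (λ f k → cong f ττ)
    term-swap
    order-swap
  where
  τ : Fin m → Fin m
  τ = Components.transpose i i′
  ττ : ∀ {k} → τ (τ k) ≡ k
  ττ = transpose-involutive i i′
  term-swap : ∀ f →
    does (injective? (f ∘ τ)) ∧ 𝔽₂Σ.∏ (λ k → A k (f (τ k))) ≡ does (injective? f) ∧ 𝔽₂Σ.∏ (λ k → A k (f k))
  term-swap f = cong₂ _∧_
    (injective?-⇔ (f ∘ τ) f
      (λ inj {x} {y} eq →
         trans (sym ττ) (trans (cong τ (inj {τ x} {τ y} (trans (cong f ττ) (trans eq (cong f (sym ττ)))))) ττ))
      (λ inj {x} {y} eq → trans (sym ττ) (trans (cong τ (inj {τ x} {τ y} eq)) ττ)))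
    (trans (𝔽₂Σ.∏-cong (λ k → sym (transpose-fixes (λ r → A r (f (τ k))) (Ai≗Ai′ (f (τ k))) k)))
           (sym (∏-permute (Permutation.transpose i i′) (λ k → A k (f k)))))
  order-swap : ∀ f → does (injective? f) ∧ 𝔽₂Σ.∏ (λ k → A k (f k)) ≡ true →
    does (f (τ i) <? f (τ i′)) ≡ not (does (f i <? f i′))
  order-swap f term≡t = trans (cong₂ (λ a b → does (f a <? f b)) (transpose-matchˡ i i′) (transpose-matchʳ i i′))
    (<-flip (λ fi≡fi′ → i≢i′ (dec-true⁻¹ (injective? f) (∧≡true⇒ˡ term≡t) fi≡fi′)))

leibniz-rows : ∀ {m} (B : Mat m) (g : Fin m → Fin m) → leibniz (λ i → B (g i)) ≡ does (injective? g) ∧ leibniz B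
leibniz-rows B g with injective? g
... | yes g-inj = trans (leibniz-permuteRows B (injective⇒permutation g g-inj))
                        (cong (_∧ leibniz B) (sym (dec-true (injective? g) g-inj)))
... | no  ¬inj  with ¬injective⇒collision g ¬inj
...   | i , i′ , i≢i′ , gi≡gi′ = trans (leibniz-equalRows (λ i → B (g i)) i≢i′ (λ c → cong (λ r → B r c) gi≡gi′))
                                       (cong (_∧ leibniz B) (sym (dec-false (injective? g) ¬inj)))

leibniz-· : ∀ {m} (A B : Mat m) → leibniz (A · B) ≡ leibniz A ∧ leibniz B
leibniz-· {m} A B = begin
  leibniz (A · B)
    ≡⟨ 𝔽₂Σ.∑-cong Fs (λ f → cong (does (injective? f) ∧_) (expand-product f)) ⟩
  𝔽₂Σ.∑ Fs (λ f → does (injective? f) ∧ 𝔽₂Σ.∑ Fs (λ g → ∏A g ∧ ∏B∘ g f))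
    ≡⟨ 𝔽₂Σ.∑-cong Fs (λ f → trans (𝔽₂Σ.*-distribˡ-∑ (does (injective? f)) Fs _)
                                 (𝔽₂Σ.∑-cong Fs (λ g → ∧-x∙yz≈y∙xz (does (injective? f)) (∏A g) (∏B∘ g f)))) ⟩
  𝔽₂Σ.∑ Fs (λ f → 𝔽₂Σ.∑ Fs (λ g → ∏A g ∧ (does (injective? f) ∧ ∏B∘ g f)))
    ≡⟨ 𝔽₂Σ.∑-comm Fs Fs _ ⟩
  𝔽₂Σ.∑ Fs (λ g → 𝔽₂Σ.∑ Fs (λ f → ∏A g ∧ (does (injective? f) ∧ ∏B∘ g f)))
    ≡⟨ 𝔽₂Σ.∑-cong Fs (λ g → sym (𝔽₂Σ.*-distribˡ-∑ (∏A g) Fs _)) ⟩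
  𝔽₂Σ.∑ Fs (λ g → ∏A g ∧ leibniz (λ i → B (g i)))
    ≡⟨ 𝔽₂Σ.∑-cong Fs (λ g → trans (cong (∏A g ∧_) (leibniz-rows B g)) (∧-x∙yz≈yx∙z (∏A g) _ (leibniz B))) ⟩
  𝔽₂Σ.∑ Fs (λ g → (does (injective? g) ∧ ∏A g) ∧ leibniz B)
    ≡⟨ 𝔽₂Σ.*-distribʳ-∑ (leibniz B) Fs _ ⟨
  leibniz A ∧ leibniz B ∎
  where
  open ≡.≡-Reasoning
  Fs = allFuns m (allFin m)
  ∏A : (Fin m → Fin m) → Bool
  ∏A g = 𝔽₂Σ.∏ (λ i → A i (g i))
  ∏B∘ : (Fin m → Fin m) → (Fin m → Fin m) → Bool
  ∏B∘ g f = 𝔽₂Σ.∏ (λ i → B (g i) (f i))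
  expand-product : ∀ f → 𝔽₂Σ.∏ (λ i → (A · B) i (f i)) ≡ 𝔽₂Σ.∑ Fs (λ g → ∏A g ∧ ∏B∘ g f)
  expand-product f = begin
    𝔽₂Σ.∏ (λ i → (A · B) i (f i))
      ≡⟨ 𝔽₂Σ.∏-cong (λ i → sumZ2≡∑ (allFin m) (λ k → A i k ∧ B k (f i))) ⟩
    𝔽₂Σ.∏ (λ i → 𝔽₂Σ.∑ (allFin m) (λ k → A i k ∧ B k (f i)))
      ≡⟨ 𝔽₂Σ.∏-∑-allFuns m (allFin m) (λ i k → A i k ∧ B k (f i)) ⟩
    𝔽₂Σ.∑ Fs (λ g → 𝔽₂Σ.∏ (λ i → A i (g i) ∧ B (g i) (f i)))
      ≡⟨ 𝔽₂Σ.∑-cong Fs (λ g → ∧-∑-distrib-+ (λ i → A i (g i)) (λ i → B (g i) (f i))) ⟩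
    𝔽₂Σ.∑ Fs (λ g → ∏A g ∧ ∏B∘ g f) ∎

leibniz-permutationMatrix : ∀ {m} (π : Fin m → Fin m) → Injective _≡_ _≡_ π → leibniz (λ i j → does (j ≟ π i)) ≡ true
leibniz-permutationMatrix {m} π π-inj = begin
  leibniz (λ i j → does (j ≟ π i))
    ≡⟨ 𝔽₂Σ.∑-cong (allFuns m (allFin m)) (λ f →
         trans (cong (does (injective? f) ∧_) (∏-does (λ i → f i ≟ π i))) (∧-as-when (does (injective? f)) (f ≈ᵇ π))) ⟩
  𝔽₂Σ.∑ (allFuns m (allFin m)) (λ f → 𝔽₂Σ.when (f ≈ᵇ π) (does (injective? f)))
    ≡⟨ 𝔽₂Σ.∑-select (Fun-enumeration m m) π (λ f → does (injective? f)) injective?-cong ⟩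
  does (injective? π)
    ≡⟨ dec-true (injective? π) π-inj ⟩
  true ∎
  where
  open ≡.≡-Reasoning
  open Enumeration (Fun-enumeration m m) using (_≈ᵇ_)
  ∧-as-when : ∀ a b → a ∧ b ≡ 𝔽₂Σ.when b a
  ∧-as-when a true  = ∧-identityʳ a
  ∧-as-when a false = ∧-zeroʳ a

isometry⇒det≡true : ∀ {m} (K M : Mat m) → (∀ i j → (transpose K · (M · K)) i j ≡ M i j) → det M ≡ true → det K ≡ true
isometry⇒det≡true K M KᵀMK≡M detM≡t =
  trans (det≡leibniz K) (∧≡true⇒ʳ {leibniz M} (∧≡true⇒ʳ {leibniz (transpose K)} (begin
  leibniz (transpose K) ∧ (leibniz M ∧ leibniz K)
    ≡⟨ cong (leibniz (transpose K) ∧_) (leibniz-· M K) ⟨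
  leibniz (transpose K) ∧ leibniz (M · K)
    ≡⟨ leibniz-· (transpose K) (M · K) ⟨
  leibniz (transpose K · (M · K))
    ≡⟨ leibniz-cong KᵀMK≡M ⟩
  leibniz M
    ≡⟨ det≡leibniz M ⟨
  det M
    ≡⟨ detM≡t ⟩
  true ∎)))
  where open ≡.≡-Reasoning

-- The symplectic form and transvections

σ : ∀ n → Fin (n + n) → Fin (n + n)
σ n i = [ (λ a → n ↑ʳ opposite a) , (λ b → opposite b ↑ˡ n) ]′ (splitAt n i)

σ-↑ˡ : ∀ n a → σ n (a ↑ˡ n) ≡ n ↑ʳ opposite a
σ-↑ˡ n a = cong [ (λ a → n ↑ʳ opposite a) , (λ b → opposite b ↑ˡ n) ]′ (splitAt-↑ˡ n a n)

σ-↑ʳ : ∀ n b → σ n (n ↑ʳ b) ≡ opposite b ↑ˡ n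
σ-↑ʳ n b = cong [ (λ a → n ↑ʳ opposite a) , (λ b → opposite b ↑ˡ n) ]′ (splitAt-↑ʳ n n b)

σ-involutive : ∀ n i → σ n (σ n i) ≡ i
σ-involutive n i with splitAt n i in split
... | inj₁ a = trans (σ-↑ʳ n (opposite a)) (trans (cong (_↑ˡ n) (opposite-involutive a)) (splitAt⁻¹-↑ˡ split))
... | inj₂ b = trans (σ-↑ˡ n (opposite b)) (trans (cong (n ↑ʳ_) (opposite-involutive b)) (splitAt⁻¹-↑ʳ split))

σ-injective : ∀ n → Injective _≡_ _≡_ (σ n)
σ-injective n {i} {j} σi≡σj = trans (sym (σ-involutive n i)) (trans (cong (σ n) σi≡σj) (σ-involutive n j))

σ-permutation : ∀ n → Permutation′ (n + n)
σ-permutation n = permutation (σ n) (σ n) (σ-involutive n) (σ-involutive n)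

Mmat≡σ : ∀ n i j → Mmat n i j ≡ does (j ≟ σ n i)
Mmat≡σ n i j with splitAt n i | splitAt n j in sj
... | inj₁ a | inj₁ b =
  sym (dec-false (j ≟ n ↑ʳ opposite a) (λ j≡ → ↑ˡ≢↑ʳ b (opposite a) (trans (splitAt⁻¹-↑ˡ sj) j≡)))
... | inj₁ a | inj₂ b = trans (sym (injective⇒does-≟ (n ↑ʳ_) (↑ʳ-injective n _ _) b (opposite a)))
                              (cong (λ j → does (j ≟ n ↑ʳ opposite a)) (splitAt⁻¹-↑ʳ sj))
... | inj₂ a | inj₁ b = trans (sym (injective⇒does-≟ (_↑ˡ n) (↑ˡ-injective n _ _) b (opposite a)))
                              (cong (λ j → does (j ≟ opposite a ↑ˡ n)) (splitAt⁻¹-↑ˡ sj))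
... | inj₂ a | inj₂ b =
  sym (dec-false (j ≟ opposite a ↑ˡ n) (λ j≡ → ↑ˡ≢↑ʳ (opposite a) b (sym (trans (splitAt⁻¹-↑ʳ sj) j≡))))

e : ∀ {m} → Fin m → Vector Bool m
e a b = does (b ≟ a)

infixl 8 _⊙_
_⊙_ : ∀ {m} → Mat m → Vector Bool m → Vector Bool m
(K ⊙ u) r = ∑[ c < _ ] (K r c ∧ u c)

col : ∀ {m} → Mat m → Fin m → Vector Bool m
col K j a = K a j

⊙-e : ∀ {m} (K : Mat m) a → K ⊙ e a ≗ col K a
⊙-e K a r = trans (sum-cong-≗ (λ c → ∧-comm (K r c) (does (c ≟ a)))) (sum-select a (K r))

module BoolVectors (k : ℕ) where

  V-enumeration : Enumeration (Vector Bool k)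
  V-enumeration = →-enumeration k Bool-enumeration

  Mat-enumeration : Enumeration (Mat k)
  Mat-enumeration = →-enumeration k V-enumeration

  vectors : List (Vector Bool k)
  vectors = Enumeration.elements V-enumeration

  matrices : List (Mat k)
  matrices = Enumeration.elements Mat-enumeration

  open Enumeration V-enumeration public
    using () renaming (_≈?_ to _≈ᵛ?_; _≈ᵇ_ to _≈ᵛ_; ≈ᵇ-sym to ≈ᵛ-sym; ≈ᵇ-cong to ≈ᵛ-cong)

  0ᵥ : Vector Bool k
  0ᵥ _ = false

  nonzero : Vector Bool k → Bool
  nonzero v = not (v ≈ᵛ 0ᵥ)

  nonzero-witness : ∀ v → nonzero v ≡ true → ∃ λ a → v a ≡ true
  nonzero-witness v v≢0 with ¬∀⟶∃¬ k _ (λ a → v a Boolₚ.≟ false)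
                                   (dec-false⁻¹ (_≈ᵛ?_ v 0ᵥ) (not-injective v≢0))
  ... | a , va≢false = a , ¬-not va≢false

  ⊙-cong : ∀ {K K′ : Mat k} u → (∀ r c → K r c ≡ K′ r c) → K ⊙ u ≗ K′ ⊙ u
  ⊙-cong u K≈K′ r = sum-cong-≗ (λ c → cong (_∧ u c) (K≈K′ r c))

  ∑-split-zero : (h : Vector Bool k → ℤ) → (∀ {x y} → x ≗ y → h x ≡ h y) →
    ℤΣ.∑ vectors h ≡ h 0ᵥ ℤ.+ ℤΣ.∑ vectors (λ v → ℤΣ.when (nonzero v) (h v))
  ∑-split-zero h h-cong = begin
    ℤΣ.∑ vectors h
      ≡⟨ ℤΣ.∑-cong vectors (λ v → split (v ≈ᵛ 0ᵥ) (h v)) ⟩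
    ℤΣ.∑ vectors (λ v → ℤΣ.when (v ≈ᵛ 0ᵥ) (h v) ℤ.+ ℤΣ.when (nonzero v) (h v))
      ≡⟨ ℤΣ.∑-distrib-+ vectors (λ v → ℤΣ.when (v ≈ᵛ 0ᵥ) (h v)) (λ v → ℤΣ.when (nonzero v) (h v)) ⟩
    ℤΣ.∑ vectors (λ v → ℤΣ.when (v ≈ᵛ 0ᵥ) (h v)) ℤ.+ ℤΣ.∑ vectors (λ v → ℤΣ.when (nonzero v) (h v))
      ≡⟨ cong (ℤ._+ ℤΣ.∑ vectors (λ v → ℤΣ.when (nonzero v) (h v))) (ℤΣ.∑-select V-enumeration 0ᵥ h h-cong) ⟩
    h 0ᵥ ℤ.+ ℤΣ.∑ vectors (λ v → ℤΣ.when (nonzero v) (h v)) ∎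
    where
    open ≡.≡-Reasoning
    split : ∀ b x → x ≡ ℤΣ.when b x ℤ.+ ℤΣ.when (not b) x
    split true  x = sym (ℤₚ.+-identityʳ x)
    split false x = sym (ℤₚ.+-identityˡ x)

  count-nonzero : ℤΣ.∑ vectors (λ v → ℤΣ.when (nonzero v) (+ 1)) ≡ + (2 ^ k ∸ 1)
  count-nonzero = ℤ+-cancelˡ (+ 1) _ _ (begin
    + 1 ℤ.+ ℤΣ.∑ vectors (λ v → ℤΣ.when (nonzero v) (+ 1))  ≡⟨ ∑-split-zero (λ _ → + 1) (λ _ → refl) ⟨
    ℤΣ.∑ vectors (λ _ → + 1)                                  ≡⟨ ∑-vectors-const k (+ 1) ⟩
    + (2 ^ k) ℤ.* + 1                                         ≡⟨ ℤₚ.*-identityʳ (+ (2 ^ k)) ⟩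
    + (2 ^ k)                                                 ≡⟨ cong +_ (ℕₚ.m∸n+n≡m (ℕₚ.m^n>0 2 k)) ⟨
    + (2 ^ k ∸ 1 + 1)                                         ≡⟨ cong +_ (ℕₚ.+-comm (2 ^ k ∸ 1) 1) ⟩
    + 1 ℤ.+ + (2 ^ k ∸ 1)                                     ∎)
    where open ≡.≡-Reasoning

module Symplectic (n : ℕ) where

  N : ℕ
  N = n + n

  V : Set
  V = Vector Bool N

  open BoolVectors N public

  -- ω x y = xᵀ M y
  ω : V → V → Bool
  ω x y = ∑[ a < N ] (x a ∧ y (σ n a))

  transpose·M·≡ω : ∀ (K : Mat N) i j → (transpose K · (Mmat n · K)) i j ≡ ω (col K i) (col K j)
  transpose·M·≡ω K i j = trans (sumZ2-allFin (λ a → K a i ∧ (Mmat n · K) a j)) (sum-cong-≗ λ a → cong (K a i ∧_) (begin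
    (Mmat n · K) a j                          ≡⟨ sumZ2-allFin (λ b → Mmat n a b ∧ K b j) ⟩
    ∑[ b < N ] (Mmat n a b ∧ K b j)           ≡⟨ sum-cong-≗ (λ b → cong (_∧ K b j) (Mmat≡σ n a b)) ⟩
    ∑[ b < N ] (does (b ≟ σ n a) ∧ K b j)     ≡⟨ sum-select (σ n a) (col K j) ⟩
    K (σ n a) j                               ∎))
    where open ≡.≡-Reasoning

  ω-cong : ∀ {x x′ y y′ : V} → x ≗ x′ → y ≗ y′ → ω x y ≡ ω x′ y′
  ω-cong x≗x′ y≗y′ = sum-cong-≗ (λ a → cong₂ _∧_ (x≗x′ a) (y≗y′ (σ n a)))

  ω-sym : ∀ x y → ω x y ≡ ω y x
  ω-sym x y = trans (sum-permute (λ a → x a ∧ y (σ n a)) (σ-permutation n))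
    (sum-cong-≗ (λ a → trans (cong (x (σ n a) ∧_) (cong y (σ-involutive n a))) (∧-comm (x (σ n a)) (y a))))

  ω-alternating : ∀ x → ω x x ≡ false
  ω-alternating x = begin
    ω x x
      ≡⟨ sum-↑ n (λ a → x a ∧ x (σ n a)) ⟩
    (∑[ a < n ] (x (a ↑ˡ n) ∧ x (σ n (a ↑ˡ n)))) xor (∑[ b < n ] (x (n ↑ʳ b) ∧ x (σ n (n ↑ʳ b))))
      ≡⟨ cong₂ _xor_ (sum-cong-≗ (λ a → cong (λ c → x (a ↑ˡ n) ∧ x c) (σ-↑ˡ n a)))
                     (sum-cong-≗ (λ b → cong (λ c → x (n ↑ʳ b) ∧ x c) (σ-↑ʳ n b))) ⟩
    (∑[ a < n ] (x (a ↑ˡ n) ∧ x (n ↑ʳ opposite a))) xor (∑[ b < n ] (x (n ↑ʳ b) ∧ x (opposite b ↑ˡ n)))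
      ≡⟨ cong (∑[ a < n ] (x (a ↑ˡ n) ∧ x (n ↑ʳ opposite a)) xor_)
           (trans (sum-permute (λ b → x (n ↑ʳ b) ∧ x (opposite b ↑ˡ n)) Permutation.reverse) (sum-cong-≗ (λ a →
           trans (cong (λ c → x (n ↑ʳ opposite a) ∧ x (c ↑ˡ n)) (opposite-involutive a))
                 (∧-comm (x (n ↑ʳ opposite a)) (x (a ↑ˡ n)))))) ⟩
    (∑[ a < n ] (x (a ↑ˡ n) ∧ x (n ↑ʳ opposite a))) xor (∑[ a < n ] (x (a ↑ˡ n) ∧ x (n ↑ʳ opposite a)))
      ≡⟨ xor-same (∑[ a < n ] (x (a ↑ˡ n) ∧ x (n ↑ʳ opposite a))) ⟩
    false ∎
    where open ≡.≡-Reasoning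

  ω-xorʳ : ∀ x y z → ω x (λ a → y a xor z a) ≡ ω x y xor ω x z
  ω-xorʳ x y z = trans (sum-cong-≗ (λ a → ∧-distribˡ-xor (x a) (y (σ n a)) (z (σ n a))))
                       (sum-distrib-xor (λ a → x a ∧ y (σ n a)) (λ a → x a ∧ z (σ n a)))

  ω-∧ʳ : ∀ x c y → ω x (λ a → c ∧ y a) ≡ c ∧ ω x y
  ω-∧ʳ x c y =
    trans (sum-cong-≗ (λ a → ∧-x∙yz≈y∙xz (x a) c (y (σ n a)))) (sym (*-distribˡ-sum c (λ a → x a ∧ y (σ n a))))

  ω-zeroˡ : ∀ {x} y → (∀ a → x a ≡ false) → ω x y ≡ false
  ω-zeroˡ y x≡0 = sum-zero (λ a → cong (_∧ y (σ n a)) (x≡0 a))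

  ω-zeroʳ : ∀ x {y} → (∀ a → y a ≡ false) → ω x y ≡ false
  ω-zeroʳ x y≡0 = sum-zero (λ a → trans (cong (x a ∧_) (y≡0 (σ n a))) (∧-zeroʳ (x a)))

  ω-eˡ : ∀ a y → ω (e a) y ≡ y (σ n a)
  ω-eˡ a y = sum-select a (y ∘ σ n)

  ω-e : ∀ x a → ω x (e (σ n a)) ≡ x a
  ω-e x a = trans
    (sum-cong-≗ (λ c → trans (cong (x c ∧_) (injective⇒does-≟ (σ n) (σ-injective n) c a)) (∧-comm (x c) _)))
                  (sum-select a x)

  ω-⊙ʳ : ∀ x (K : Mat N) u → ω x (K ⊙ u) ≡ ∑[ c < N ] (u c ∧ ω x (col K c))
  ω-⊙ʳ x K u = begin
    ∑[ a < N ] (x a ∧ ∑[ c < N ] (K (σ n a) c ∧ u c))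
      ≡⟨ sum-cong-≗ (λ a → *-distribˡ-sum (x a) (λ c → K (σ n a) c ∧ u c)) ⟩
    ∑[ a < N ] ∑[ c < N ] (x a ∧ (K (σ n a) c ∧ u c))
      ≡⟨ sum-comm (λ a c → x a ∧ (K (σ n a) c ∧ u c)) ⟩
    ∑[ c < N ] ∑[ a < N ] (x a ∧ (K (σ n a) c ∧ u c))
      ≡⟨ sum-cong-≗ (λ c → trans (sum-cong-≗ (λ a → ∧-x∙yz≈z∙xy (x a) (K (σ n a) c) (u c)))
                                 (sym (*-distribˡ-sum (u c) (λ a → x a ∧ K (σ n a) c)))) ⟩
    ∑[ c < N ] (u c ∧ ω x (col K c)) ∎
    where open ≡.≡-Reasoning

  transvection : V → V → V
  transvection w y a = y a xor (ω w y ∧ w a)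

  transvection-cong : ∀ w {y y′} → y ≗ y′ → transvection w y ≗ transvection w y′
  transvection-cong w y≗y′ a = cong₂ (λ p q → p xor (q ∧ w a)) (y≗y′ a) (ω-cong (λ _ → refl) y≗y′)

  ω-transvection-w : ∀ w y → ω w (transvection w y) ≡ ω w y
  ω-transvection-w w y = begin
    ω w (transvection w y)                   ≡⟨ ω-xorʳ w y (λ a → ω w y ∧ w a) ⟩
    ω w y xor ω w (λ a → ω w y ∧ w a)        ≡⟨ cong (ω w y xor_) (ω-∧ʳ w (ω w y) w) ⟩
    ω w y xor (ω w y ∧ ω w w)                ≡⟨ cong (λ b → ω w y xor (ω w y ∧ b)) (ω-alternating w) ⟩
    ω w y xor (ω w y ∧ false)                ≡⟨ cong (ω w y xor_) (∧-zeroʳ (ω w y)) ⟩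
    ω w y xor false                          ≡⟨ xor-identityʳ (ω w y) ⟩
    ω w y                                    ∎
    where open ≡.≡-Reasoning

  transvection-involutive : ∀ w y → transvection w (transvection w y) ≗ y
  transvection-involutive w y a = begin
    (y a xor (ω w y ∧ w a)) xor (ω w (transvection w y) ∧ w a)
      ≡⟨ cong (λ b → (y a xor (ω w y ∧ w a)) xor (b ∧ w a)) (ω-transvection-w w y) ⟩
    (y a xor (ω w y ∧ w a)) xor (ω w y ∧ w a)
      ≡⟨ xor-assoc (y a) _ _ ⟩
    y a xor ((ω w y ∧ w a) xor (ω w y ∧ w a))
      ≡⟨ cong (y a xor_) (xor-same (ω w y ∧ w a)) ⟩
    y a xor false
      ≡⟨ xor-identityʳ (y a) ⟩
    y a ∎
    where open ≡.≡-Reasoning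

  ω-transvection : ∀ w x y → ω (transvection w x) (transvection w y) ≡ ω x y
  ω-transvection w x y = begin
    ω (transvection w x) (transvection w y)
      ≡⟨ ω-xorʳ (transvection w x) y (λ a → ω w y ∧ w a) ⟩
    ω (transvection w x) y xor ω (transvection w x) (λ a → ω w y ∧ w a)
      ≡⟨ cong₂ _xor_ (trans (ω-sym (transvection w x) y) (ω-xorʳ y x (λ a → ω w x ∧ w a)))
                     (ω-∧ʳ (transvection w x) (ω w y) w) ⟩
    (ω y x xor ω y (λ a → ω w x ∧ w a)) xor (ω w y ∧ ω (transvection w x) w)
      ≡⟨ cong₂ (λ p q → (ω y x xor p) xor (ω w y ∧ q))
               (trans (ω-∧ʳ y (ω w x) w) (cong (ω w x ∧_) (ω-sym y w)))
               (trans (ω-sym (transvection w x) w) (ω-transvection-w w x)) ⟩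
    (ω y x xor (ω w x ∧ ω w y)) xor (ω w y ∧ ω w x)
      ≡⟨ cancel (ω y x) (ω w x) (ω w y) ⟩
    ω y x
      ≡⟨ ω-sym y x ⟩
    ω x y ∎
    where
    open ≡.≡-Reasoning
    cancel : ∀ a b c → (a xor (b ∧ c)) xor (c ∧ b) ≡ a
    cancel a b c = trans (xor-assoc a (b ∧ c) (c ∧ b))
      (trans (cong (λ d → a xor ((b ∧ c) xor d)) (∧-comm c b))
        (trans (cong (a xor_) (xor-same (b ∧ c))) (xor-identityʳ a)))

  transvectionᴹ : V → Mat N → Mat N
  transvectionᴹ w K r c = transvection w (col K c) r

  ⊙-transvectionᴹ : ∀ w K u → transvectionᴹ w K ⊙ u ≗ transvection w (K ⊙ u)
  ⊙-transvectionᴹ w K u r = begin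
    ∑[ c < N ] ((K r c xor (ω w (col K c) ∧ w r)) ∧ u c)
      ≡⟨ sum-cong-≗ (λ c → ∧-distribʳ-xor (u c) (K r c) (ω w (col K c) ∧ w r)) ⟩
    ∑[ c < N ] ((K r c ∧ u c) xor ((ω w (col K c) ∧ w r) ∧ u c))
      ≡⟨ sum-distrib-xor (λ c → K r c ∧ u c) (λ c → (ω w (col K c) ∧ w r) ∧ u c) ⟩
    (K ⊙ u) r xor ∑[ c < N ] ((ω w (col K c) ∧ w r) ∧ u c)
      ≡⟨ cong ((K ⊙ u) r xor_) (begin
          ∑[ c < N ] ((ω w (col K c) ∧ w r) ∧ u c)
            ≡⟨ sum-cong-≗ (λ c → ∧-xy∙z≈zx∙y (ω w (col K c)) (w r) (u c)) ⟩
          ∑[ c < N ] ((u c ∧ ω w (col K c)) ∧ w r)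
            ≡⟨ *-distribʳ-sum (w r) (λ c → u c ∧ ω w (col K c)) ⟨
          ∑[ c < N ] (u c ∧ ω w (col K c)) ∧ w r
            ≡⟨ cong (_∧ w r) (ω-⊙ʳ w K u) ⟨
          ω w (K ⊙ u) ∧ w r ∎) ⟩
    transvection w (K ⊙ u) r ∎
    where open ≡.≡-Reasoning

  -- KᵀMK = M, read off entry by entry.
  Symplectic : Mat N → Set
  Symplectic K = ∀ i j → ω (col K i) (col K j) ≡ does (j ≟ σ n i)

  symplectic? : ∀ K → Dec (Symplectic K)
  symplectic? K = all? λ i → all? λ j → ω (col K i) (col K j) Boolₚ.≟ does (j ≟ σ n i)

  symplectic-transvectionᴹ : ∀ w K → does (symplectic? (transvectionᴹ w K)) ≡ does (symplectic? K)
  symplectic-transvectionᴹ w K = does-⇔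
    (mk⇔ (λ sp i j → trans (sym (ω-transvection w (col K i) (col K j))) (sp i j))
         (λ sp i j → trans (ω-transvection w (col K i) (col K j)) (sp i j)))
    (symplectic? (transvectionᴹ w K)) (symplectic? K)

  symplectic?-cong : ∀ {K K′ : Mat N} → (∀ r c → K r c ≡ K′ r c) → does (symplectic? K) ≡ does (symplectic? K′)
  symplectic?-cong {K} {K′} K≈K′ = does-⇔
    (mk⇔ (λ sp i j → trans (ω-cong (λ a → sym (K≈K′ a i)) (λ a → sym (K≈K′ a j))) (sp i j))
         (λ sp i j → trans (ω-cong (λ a → K≈K′ a i) (λ a → K≈K′ a j)) (sp i j)))
    (symplectic? K) (symplectic? K′)

  isSymplectic⇔symplectic : ∀ K → IsSymplectic n K ⇔ Symplectic K
  isSymplectic⇔symplectic K = mk⇔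
    (λ (_ , KᵀMK≡M) i j → trans (sym (transpose·M·≡ω K i j)) (trans (KᵀMK≡M i j) (Mmat≡σ n i j)))
    (λ sp → let KᵀMK≡M = λ i j → trans (transpose·M·≡ω K i j) (trans (sp i j) (sym (Mmat≡σ n i j))) in
            isometry⇒det≡true K (Mmat n) KᵀMK≡M det-M , KᵀMK≡M)
    where
    det-M : det (Mmat n) ≡ true
    det-M = trans (det≡leibniz (Mmat n))
                  (trans (leibniz-cong (Mmat≡σ n)) (leibniz-permutationMatrix (σ n) (σ-injective n)))

  does-isSymplectic? : ∀ K → does (isSymplectic? n K) ≡ does (symplectic? K)
  does-isSymplectic? K = does-⇔ (isSymplectic⇔symplectic K) (isSymplectic? n K) (symplectic? K)

  ω-col-⊙ : ∀ K u a → Symplectic K → ω (col K (σ n a)) (K ⊙ u) ≡ u a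
  ω-col-⊙ K u a sp = begin
    ω (col K (σ n a)) (K ⊙ u)                      ≡⟨ ω-⊙ʳ (col K (σ n a)) K u ⟩
    ∑[ c < N ] (u c ∧ ω (col K (σ n a)) (col K c))
      ≡⟨ sum-cong-≗ (λ c → trans (cong (u c ∧_) (sp (σ n a) c)) (∧-comm (u c) _)) ⟩
    ∑[ c < N ] (does (c ≟ σ n (σ n a)) ∧ u c)      ≡⟨ sum-select (σ n (σ n a)) u ⟩
    u (σ n (σ n a))                                ≡⟨ cong u (σ-involutive n a) ⟩
    u a                                            ∎
    where open ≡.≡-Reasoning

  symplectic⇒⊙-nonzero : ∀ K u → Symplectic K → ∃ (λ a → u a ≡ true) → ¬ (∀ r → (K ⊙ u) r ≡ false)
  symplectic⇒⊙-nonzero K u sp (a , ua≡t) K⊙u≡0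
    with () ← trans (sym (ω-zeroʳ (col K (σ n a)) K⊙u≡0)) (trans (ω-col-⊙ K u a sp) ua≡t)

  Spᵇ : Mat N → Bool
  Spᵇ K = does (symplectic? K)

  |Sp| : ℤ
  |Sp| = ℤΣ.∑ matrices (λ K → ℤΣ.when (Spᵇ K) (+ 1))

  transvection-≈ᵛ : ∀ w x y → (transvection w x ≈ᵛ transvection w y) ≡ (x ≈ᵛ y)
  transvection-≈ᵛ w x y = does-⇔
    (mk⇔ (λ Tx≗Ty a → trans (sym (transvection-involutive w x a))
                        (trans (transvection-cong w Tx≗Ty a) (transvection-involutive w y a)))
         (transvection-cong w))
    (_≈ᵛ?_ _ _) (_≈ᵛ?_ x y)

  module Orbit (u : V) where

    fiber : V → ℤ
    fiber v = ℤΣ.∑ matrices (λ K → ℤΣ.when (Spᵇ K ∧ (K ⊙ u ≈ᵛ v)) (+ 1))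

    fiber-cong : ∀ {v v′} → v ≗ v′ → fiber v ≡ fiber v′
    fiber-cong v≗v′ = ℤΣ.∑-cong matrices (λ K → cong (λ b → ℤΣ.when (Spᵇ K ∧ b) (+ 1)) (≈ᵛ-cong (λ _ → refl) v≗v′))

    fiber-transvection : ∀ w v → fiber (transvection w v) ≡ fiber v
    fiber-transvection w v = sym (trans
      (ℤΣ.∑-cong matrices (λ K → cong₂ (λ p q → ℤΣ.when (p ∧ q) (+ 1))
        (sym (symplectic-transvectionᴹ w K))
        (sym (trans (≈ᵛ-cong (⊙-transvectionᴹ w K u) (λ _ → refl)) (transvection-≈ᵛ w (K ⊙ u) v)))))
      (ℤΣ.∑-involution Mat-enumeration (transvectionᴹ w)
        (λ K≈K′ → cong₂ (λ p q → ℤΣ.when (p ∧ q) (+ 1)) (symplectic?-cong K≈K′) (≈ᵛ-cong (⊙-cong u K≈K′) (λ _ → refl)))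
        (λ K≈K′ r c → transvection-cong w (λ a → K≈K′ a c) r)
        (λ K r c → transvection-involutive w (col K c) r)))

    fiber-adjacent : ∀ v v′ → ω v v′ ≡ true → fiber v ≡ fiber v′
    fiber-adjacent v v′ ωvv′≡t = trans (sym (fiber-transvection w v)) (fiber-cong reaches)
      where
      w : V
      w a = v a xor v′ a
      ωwv≡t : ω w v ≡ true
      ωwv≡t = begin
        ω w v                ≡⟨ ω-sym w v ⟩
        ω v w                ≡⟨ ω-xorʳ v v v′ ⟩
        ω v v xor ω v v′     ≡⟨ cong₂ _xor_ (ω-alternating v) ωvv′≡t ⟩
        true                 ∎
        where open ≡.≡-Reasoning
      reaches : transvection w v ≗ v′
      reaches a rewrite ωwv≡t with v a | v′ a
      ... | true  | true  = refl
      ... | true  | false = refl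
      ... | false | _     = refl

    fiber-via : ∀ {v v′} x → ω v x ≡ true → ω v′ x ≡ true → fiber v ≡ fiber v′
    fiber-via {v} {v′} x ωvx ωv′x = trans (fiber-adjacent v x ωvx) (sym (fiber-adjacent v′ x ωv′x))

    -- Two nonzero vectors are both ω-adjacent to a basis vector or to a sum of two basis vectors.
    fiber-constant : ∀ v v′ → nonzero v ≡ true → nonzero v′ ≡ true → fiber v ≡ fiber v′
    fiber-constant v v′ v≢0 v′≢0 with nonzero-witness v v≢0 | nonzero-witness v′ v′≢0
    ... | a , va≡t | a′ , v′a′≡t with v′ a in v′a | v a′ in va′
    ... | true  | _     = fiber-via (e (σ n a)) (trans (ω-e v a) va≡t) (trans (ω-e v′ a) v′a)
    ... | false | true  = fiber-via (e (σ n a′)) (trans (ω-e v a′) va′) (trans (ω-e v′ a′) v′a′≡t)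
    ... | false | false = fiber-via (λ b → e (σ n a) b xor e (σ n a′) b)
        (trans (ω-xorʳ v (e (σ n a)) (e (σ n a′))) (cong₂ _xor_ (trans (ω-e v a) va≡t) (trans (ω-e v a′) va′)))
        (trans (ω-xorʳ v′ (e (σ n a)) (e (σ n a′))) (cong₂ _xor_ (trans (ω-e v′ a) v′a) (trans (ω-e v′ a′) v′a′≡t)))

    fiber-zero : ∃ (λ a → u a ≡ true) → fiber 0ᵥ ≡ + 0
    fiber-zero u≢0 = ℤΣ.∑-zero matrices summand-zero
      where
      summand-zero : ∀ K → ℤΣ.when (Spᵇ K ∧ (K ⊙ u ≈ᵛ 0ᵥ)) (+ 1) ≡ + 0
      summand-zero K with symplectic? K
      ... | no ¬sp = cong (λ b → ℤΣ.when (b ∧ (K ⊙ u ≈ᵛ 0ᵥ)) (+ 1)) (dec-false (symplectic? K) ¬sp)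
      ... | yes sp = cong (λ b → ℤΣ.when b (+ 1)) (trans
        (cong (Spᵇ K ∧_) (dec-false (_≈ᵛ?_ (K ⊙ u) 0ᵥ) (symplectic⇒⊙-nonzero K u sp u≢0)))
        (∧-zeroʳ (Spᵇ K)))

    ∑-Sp≡fiber*∑-nonzero : ∃ (λ a → u a ≡ true) → ∀ v₀ → nonzero v₀ ≡ true → (h : V → ℤ) → (∀ {x y} → x ≗ y → h x ≡ h y) →
      ℤΣ.∑ matrices (λ K → ℤΣ.when (Spᵇ K) (h (K ⊙ u))) ≡ fiber v₀ ℤ.* ℤΣ.∑ vectors (λ v → ℤΣ.when (nonzero v) (h v))
    ∑-Sp≡fiber*∑-nonzero u≢0 v₀ v₀≢0 h h-cong = begin
      ℤΣ.∑ matrices (λ K → ℤΣ.when (Spᵇ K) (h (K ⊙ u)))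
        ≡⟨ ℤΣ.∑-cong matrices (λ K → ℤΣ.∑-select V-enumeration (K ⊙ u) (λ v → ℤΣ.when (Spᵇ K) (h v))
                                                     (λ v≈Ku → cong (ℤΣ.when (Spᵇ K)) (h-cong v≈Ku))) ⟨
      ℤΣ.∑ matrices (λ K → ℤΣ.∑ vectors (λ v → ℤΣ.when (v ≈ᵛ K ⊙ u) (ℤΣ.when (Spᵇ K) (h v))))
        ≡⟨ ℤΣ.∑-comm matrices vectors _ ⟩
      ℤΣ.∑ vectors (λ v → ℤΣ.∑ matrices (λ K → ℤΣ.when (v ≈ᵛ K ⊙ u) (ℤΣ.when (Spᵇ K) (h v))))
        ≡⟨ ℤΣ.∑-cong vectors (λ v → trans (ℤΣ.∑-cong matrices (regroup v)) (sym (ℤΣ.*-distribʳ-∑ (h v) matrices _))) ⟩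
      ℤΣ.∑ vectors (λ v → fiber v ℤ.* h v)
        ≡⟨ ℤΣ.∑-cong vectors fiber-value ⟩
      ℤΣ.∑ vectors (λ v → fiber v₀ ℤ.* ℤΣ.when (nonzero v) (h v))
        ≡⟨ ℤΣ.*-distribˡ-∑ (fiber v₀) vectors _ ⟨
      fiber v₀ ℤ.* ℤΣ.∑ vectors (λ v → ℤΣ.when (nonzero v) (h v)) ∎
      where
      open ≡.≡-Reasoning
      regroup : ∀ v K → ℤΣ.when (v ≈ᵛ K ⊙ u) (ℤΣ.when (Spᵇ K) (h v)) ≡ ℤΣ.when (Spᵇ K ∧ (K ⊙ u ≈ᵛ v)) (+ 1) ℤ.* h v
      regroup v K = begin
        ℤΣ.when (v ≈ᵛ K ⊙ u) (ℤΣ.when (Spᵇ K) (h v))   ≡⟨ ℤΣ.when-when (v ≈ᵛ K ⊙ u) (Spᵇ K) (h v) ⟩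
        ℤΣ.when (Spᵇ K ∧ (v ≈ᵛ K ⊙ u)) (h v)          ≡⟨ cong (λ b → ℤΣ.when (Spᵇ K ∧ b) (h v)) (≈ᵛ-sym v (K ⊙ u)) ⟩
        ℤΣ.when (Spᵇ K ∧ (K ⊙ u ≈ᵛ v)) (h v)          ≡⟨ ℤΣ.when-1#* (Spᵇ K ∧ (K ⊙ u ≈ᵛ v)) (h v) ⟨
        ℤΣ.when (Spᵇ K ∧ (K ⊙ u ≈ᵛ v)) (+ 1) ℤ.* h v  ∎
      fiber-value : ∀ v → fiber v ℤ.* h v ≡ fiber v₀ ℤ.* ℤΣ.when (nonzero v) (h v)
      fiber-value v with nonzero v in v≢0
      ... | true  = cong (ℤ._* h v) (fiber-constant v v₀ v≢0 v₀≢0)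
      ... | false = begin
        fiber v ℤ.* h v     ≡⟨ cong (ℤ._* h v) (trans (fiber-cong v≈0) (fiber-zero u≢0)) ⟩
        + 0 ℤ.* h v         ≡⟨ ℤₚ.*-zeroˡ (h v) ⟩
        + 0                 ≡⟨ ℤₚ.*-zeroʳ (fiber v₀) ⟨
        fiber v₀ ℤ.* + 0    ∎
        where
        v≈0 : v ≗ 0ᵥ
        v≈0 = dec-true⁻¹ (_≈ᵛ?_ v 0ᵥ) (not-injective v≢0)

-- The stabiliser of e₀

-- Fin (suc m + suc m) splits into zero, ι (Fin (m + m)) and a last index, σ swapping zero and last.
module Splitting (m : ℕ) where

  data Part : Set where
    first  : Part
    middle : Fin (m + m) → Part
    last   : Part

  middle-injective : ∀ {j k} → middle j ≡ middle k → j ≡ k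
  middle-injective refl = refl

  _≟ᴾ_ : DecidableEquality Part
  first    ≟ᴾ first    = yes refl
  first    ≟ᴾ middle _ = no λ ()
  first    ≟ᴾ last     = no λ ()
  middle _ ≟ᴾ first    = no λ ()
  middle j ≟ᴾ middle k = map′ (cong middle) middle-injective (j ≟ k)
  middle _ ≟ᴾ last     = no λ ()
  last     ≟ᴾ first    = no λ ()
  last     ≟ᴾ middle _ = no λ ()
  last     ≟ᴾ last     = yes refl

  ι : Fin (m + m) → Fin (suc m + suc m)
  ι k = [ (λ a → suc a ↑ˡ suc m) , (λ b → suc m ↑ʳ inject₁ b) ]′ (splitAt m k)

  ι-↑ˡ : ∀ a → ι (a ↑ˡ m) ≡ suc a ↑ˡ suc m
  ι-↑ˡ a = cong [ (λ a → suc a ↑ˡ suc m) , (λ b → suc m ↑ʳ inject₁ b) ]′ (splitAt-↑ˡ m a m)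

  ι-↑ʳ : ∀ b → ι (m ↑ʳ b) ≡ suc m ↑ʳ inject₁ b
  ι-↑ʳ b = cong [ (λ a → suc a ↑ˡ suc m) , (λ b → suc m ↑ʳ inject₁ b) ]′ (splitAt-↑ʳ m m b)

  embed : Part → Fin (suc m + suc m)
  embed first      = zero
  embed (middle k) = ι k
  embed last       = suc m ↑ʳ fromℕ m

  classifyˡ : Fin (suc m) → Part
  classifyˡ zero    = first
  classifyˡ (suc a) = middle (a ↑ˡ m)

  classifyʳ : ∀ {b : Fin (suc m)} → Top.View b → Part
  classifyʳ Top.‵fromℕ        = last
  classifyʳ (Top.‵inject₁ b) = middle (m ↑ʳ b)

  classify : Fin (suc m + suc m) → Part
  classify i = [ classifyˡ , (λ b → classifyʳ (Top.view b)) ]′ (splitAt (suc m) i)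

  embed-classify : ∀ i → embed (classify i) ≡ i
  embed-classify i with splitAt (suc m) i in split
  ... | inj₁ zero    = splitAt⁻¹-↑ˡ split
  ... | inj₁ (suc a) = trans (ι-↑ˡ a) (splitAt⁻¹-↑ˡ split)
  ... | inj₂ b       = trans (embed-classifyʳ (Top.view b)) (splitAt⁻¹-↑ʳ split)
    where
    embed-classifyʳ : ∀ {b} (v : Top.View b) → embed (classifyʳ v) ≡ suc m ↑ʳ b
    embed-classifyʳ Top.‵fromℕ        = refl
    embed-classifyʳ (Top.‵inject₁ b) = ι-↑ʳ b

  classify-embed : ∀ p → classify (embed p) ≡ p
  classify-embed first      = refl
  classify-embed (middle k) = ↑-induction {P = λ k → classify (ι k) ≡ middle k}
    (λ a → trans (cong classify (ι-↑ˡ a))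
                 (cong [ classifyˡ , (λ b → classifyʳ (Top.view b)) ]′ (splitAt-↑ˡ (suc m) (suc a) (suc m))))
    (λ b → trans (cong classify (ι-↑ʳ b))
             (trans (cong [ classifyˡ , (λ b → classifyʳ (Top.view b)) ]′ (splitAt-↑ʳ (suc m) (suc m) (inject₁ b)))
                    (cong classifyʳ (Top.view-inject₁ b))))
    k
  classify-embed last =
    trans (cong [ classifyˡ , (λ b → classifyʳ (Top.view b)) ]′ (splitAt-↑ʳ (suc m) (suc m) (fromℕ m)))
                              (cong classifyʳ (Top.view-fromℕ m))

  embed-injective : ∀ {p q} → embed p ≡ embed q → p ≡ q
  embed-injective {p} {q} eq = trans (sym (classify-embed p)) (trans (cong classify eq) (classify-embed q))

  embed-≟ : ∀ p q → does (embed p ≟ embed q) ≡ does (p ≟ᴾ q)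
  embed-≟ p q = does-⇔ (mk⇔ embed-injective (cong embed)) (embed p ≟ embed q) (p ≟ᴾ q)

  σᴾ : Part → Part
  σᴾ first      = last
  σᴾ (middle k) = middle (σ m k)
  σᴾ last       = first

  σ-embed : ∀ p → σ (suc m) (embed p) ≡ embed (σᴾ p)
  σ-embed first      = refl
  σ-embed (middle k) = ↑-induction {P = λ k → σ (suc m) (ι k) ≡ ι (σ m k)}
    (λ a → trans (cong (σ (suc m)) (ι-↑ˡ a))
             (trans (σ-↑ˡ (suc m) (suc a)) (sym (trans (cong ι (σ-↑ˡ m a)) (ι-↑ʳ (opposite a))))))
    (λ b → trans (cong (σ (suc m)) (ι-↑ʳ b))
             (trans (σ-↑ʳ (suc m) (inject₁ b))
               (trans (cong (_↑ˡ suc m) (opposite-inject₁ b)) (sym (trans (cong ι (σ-↑ʳ m b)) (ι-↑ˡ (opposite b)))))))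
    k
  σ-embed last = trans (σ-↑ʳ (suc m) (fromℕ m)) (cong (_↑ˡ suc m) (opposite-fromℕ m))

  sum-parts : ∀ (F : Vector Bool (suc m + suc m)) →
    sum F ≡ F zero xor ((∑[ k < m + m ] F (ι k)) xor F (embed last))
  sum-parts F = begin
    sum F
      ≡⟨ sum-↑ (suc m) F ⟩
    (F zero xor L) xor (∑[ b < suc m ] F (suc m ↑ʳ b))
      ≡⟨ cong ((F zero xor L) xor_) (sum-init-last (λ b → F (suc m ↑ʳ b))) ⟩
    (F zero xor L) xor (R xor F (embed last))
      ≡⟨ xor-assoc (F zero) L _ ⟩
    F zero xor (L xor (R xor F (embed last)))
      ≡⟨ cong (F zero xor_) (sym (xor-assoc L R _)) ⟩
    F zero xor ((L xor R) xor F (embed last))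
      ≡⟨ cong (λ s → F zero xor (s xor F (embed last))) (sym (trans (sum-↑ m (F ∘ ι))
           (cong₂ _xor_ (sum-cong-≗ (λ a → cong F (ι-↑ˡ a))) (sum-cong-≗ (λ b → cong F (ι-↑ʳ b)))))) ⟩
    F zero xor ((∑[ k < m + m ] F (ι k)) xor F (embed last)) ∎
    where
    open ≡.≡-Reasoning
    L = ∑[ a < m ] F (suc a ↑ˡ suc m)
    R = ∑[ b < m ] F (suc m ↑ʳ inject₁ b)

module Stabilizer (m : ℕ) where
  open Splitting m
  module Big = Symplectic (suc m)
  module Small = Symplectic m

  ω-parts : ∀ x y → Big.ω x y ≡ (x zero ∧ y (embed last)) xor (Small.ω (x ∘ ι) (y ∘ ι) xor (x (embed last) ∧ y zero))
  ω-parts x y = trans (sum-parts (λ a → x a ∧ y (σ (suc m) a)))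
    (cong₂ (λ s b → (x zero ∧ y (embed last)) xor (s xor (x (embed last) ∧ y b)))
      (sum-cong-≗ (λ k → cong (λ c → x (ι k) ∧ y c) (σ-embed (middle k))))
      (σ-embed last))

  StabilizerData : Set
  StabilizerData = Bool × (Small.V × Mat (m + m))

  StabilizerData-enumeration : Enumeration StabilizerData
  StabilizerData-enumeration = ×-enumeration Bool-enumeration (×-enumeration Small.V-enumeration Small.Mat-enumeration)

  -- In the parts first, middle, last, extend (b , f , K) is the block matrix [ 1 (ω (col K j) f)ⱼ b ; 0 K f ; 0 0 1 ].
  block : StabilizerData → Part → Part → Bool
  block _           p          first      = does (p ≟ᴾ first)
  block (_ , f , K) first      (middle j) = Small.ω (col K j) f
  block (_ , _ , K) (middle k) (middle j) = K k j
  block _           last       (middle j) = false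
  block (b , _ , _) first      last       = b
  block (_ , f , _) (middle k) last       = f k
  block _           last       last       = true

  extend : StabilizerData → Mat (suc m + suc m)
  extend y r c = block y (classify r) (classify c)

  extend-embed : ∀ y p q → extend y (embed p) (embed q) ≡ block y p q
  extend-embed y p q = cong₂ (block y) (classify-embed p) (classify-embed q)

  ω-extend : ∀ y p q → Big.ω (col (extend y) (embed p)) (col (extend y) (embed q)) ≡
    (block y first p ∧ block y last q) xor
    (Small.ω (λ k → block y (middle k) p) (λ k → block y (middle k) q) xor (block y last p ∧ block y first q))
  ω-extend y p q = trans (ω-parts (col (extend y) (embed p)) (col (extend y) (embed q)))
    (cong₂ _xor_ (cong₂ _∧_ (extend-embed y first p) (extend-embed y last q))
      (cong₂ _xor_ (Small.ω-cong (λ k → extend-embed y (middle k) p) (λ k → extend-embed y (middle k) q))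
                   (cong₂ _∧_ (extend-embed y last p) (extend-embed y first q))))

  block-ω : ∀ y → Small.Symplectic (proj₂ (proj₂ y)) → ∀ p q →
    (block y first p ∧ block y last q) xor
    (Small.ω (λ k → block y (middle k) p) (λ k → block y (middle k) q) xor (block y last p ∧ block y first q))
      ≡ does (q ≟ᴾ σᴾ p)
  block-ω (b , f , K) sp first first = trans (xor-identityʳ _) (Small.ω-zeroˡ Small.0ᵥ (λ _ → refl))
  block-ω (b , f , K) sp first (middle j) = trans (xor-identityʳ _) (Small.ω-zeroˡ (col K j) (λ _ → refl))
  block-ω (b , f , K) sp first last = cong not (trans (xor-identityʳ _) (Small.ω-zeroˡ f (λ _ → refl)))
  block-ω (b , f , K) sp (middle i) first =
    cong₂ _xor_ (∧-zeroʳ (Small.ω (col K i) f))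
                (trans (xor-identityʳ (Small.ω (col K i) Small.0ᵥ)) (Small.ω-zeroʳ (col K i) (λ _ → refl)))
  block-ω (b , f , K) sp (middle i) (middle j) =
    trans (cong (_xor (Small.ω (col K i) (col K j) xor false)) (∧-zeroʳ (Small.ω (col K i) f)))
          (trans (xor-identityʳ (Small.ω (col K i) (col K j))) (sp i j))
  block-ω (b , f , K) sp (middle i) last =
    trans (cong₂ _xor_ (∧-identityʳ (Small.ω (col K i) f)) (xor-identityʳ (Small.ω (col K i) f)))
          (xor-same (Small.ω (col K i) f))
  block-ω (b , f , K) sp last first =
    cong₂ _xor_ (∧-zeroʳ b) (cong (_xor true) (Small.ω-zeroʳ f (λ _ → refl)))
  block-ω (b , f , K) sp last (middle j) =
    cong₂ _xor_ (∧-zeroʳ b)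
      (trans (cong (_xor Small.ω (col K j) f) (Small.ω-sym f (col K j))) (xor-same (Small.ω (col K j) f)))
  block-ω (b , f , K) sp last last =
    trans (cong₂ _xor_ (∧-identityʳ b) (cong (_xor b) (Small.ω-alternating f))) (xor-same b)

  middle-block-ω : ∀ y i j →
    (block y first (middle i) ∧ block y last (middle j)) xor
    (Small.ω (λ k → block y (middle k) (middle i)) (λ k → block y (middle k) (middle j)) xor
     (block y last (middle i) ∧ block y first (middle j)))
      ≡ Small.ω (col (proj₂ (proj₂ y)) i) (col (proj₂ (proj₂ y)) j)
  middle-block-ω (b , f , K) i j =
    trans (cong (_xor (Small.ω (col K i) (col K j) xor false)) (∧-zeroʳ (Small.ω (col K i) f)))
          (xor-identityʳ (Small.ω (col K i) (col K j)))

  extend-symplectic : ∀ y → Big.Symplectic (extend y) ⇔ Small.Symplectic (proj₂ (proj₂ y))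
  extend-symplectic y = mk⇔
    (λ sp i j → begin
      Small.ω (col K i) (col K j)
        ≡⟨ trans (sym (middle-block-ω y i j)) (sym (ω-extend y (middle i) (middle j))) ⟩
      Big.ω (col (extend y) (ι i)) (col (extend y) (ι j))
        ≡⟨ sp (ι i) (ι j) ⟩
      does (ι j ≟ σ (suc m) (ι i))
        ≡⟨ cong (λ c → does (ι j ≟ c)) (σ-embed (middle i)) ⟩
      does (embed (middle j) ≟ embed (middle (σ m i)))
        ≡⟨ embed-≟ (middle j) (middle (σ m i)) ⟩
      does (j ≟ σ m i) ∎)
    (λ sp r c → subst₂ (λ r c → Big.ω (col (extend y) r) (col (extend y) c) ≡ does (c ≟ σ (suc m) r))
                       (embed-classify r) (embed-classify c) (on-parts sp (classify r) (classify c)))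
    where
    open ≡.≡-Reasoning
    K = proj₂ (proj₂ y)
    on-parts : Small.Symplectic K → ∀ p q →
      Big.ω (col (extend y) (embed p)) (col (extend y) (embed q)) ≡ does (embed q ≟ σ (suc m) (embed p))
    on-parts sp p q = begin
      Big.ω (col (extend y) (embed p)) (col (extend y) (embed q)) ≡⟨ ω-extend y p q ⟩
      _                                                           ≡⟨ block-ω y sp p q ⟩
      does (q ≟ᴾ σᴾ p)                                            ≡⟨ embed-≟ q (σᴾ p) ⟨
      does (embed q ≟ embed (σᴾ p))                               ≡⟨ cong (λ c → does (embed q ≟ c)) (σ-embed p) ⟨
      does (embed q ≟ σ (suc m) (embed p))                        ∎

  extend-fixes-e₀ : ∀ y → col (extend y) zero ≗ e zero
  extend-fixes-e₀ y a =
    sym (trans (cong (λ i → does (i ≟ zero)) (sym (embed-classify a))) (embed-≟ (classify a) first))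

  block-cong : ∀ {y y′} → Enumeration._≈_ StabilizerData-enumeration y y′ → ∀ p q → block y p q ≡ block y′ p q
  block-cong _                     p          first      = refl
  block-cong (_ , f≈f′ , K≈K′)     first      (middle j) = Small.ω-cong (λ k → K≈K′ k j) f≈f′
  block-cong (_ , _ , K≈K′)        (middle k) (middle j) = K≈K′ k j
  block-cong _                     last       (middle j) = refl
  block-cong (b≡b′ , _ , _)        first      last       = b≡b′
  block-cong (_ , f≈f′ , _)        (middle k) last       = f≈f′ k
  block-cong _                     last       last       = refl

  extend-injective : ∀ {y y′} → (∀ r c → extend y r c ≡ extend y′ r c) →
    Enumeration._≈_ StabilizerData-enumeration y y′
  extend-injective {y} {y′} extend≈ = at first last , (λ k → at (middle k) last) , (λ i j → at (middle i) (middle j))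
    where
    at : ∀ p q → block y p q ≡ block y′ p q
    at p q = trans (sym (extend-embed y p q)) (trans (extend≈ (embed p) (embed q)) (extend-embed y′ p q))

  restrict : Mat (suc m + suc m) → StabilizerData
  restrict K = K zero (embed last) , (λ k → K (ι k) (embed last)) , (λ i j → K (ι i) (ι j))

  module _ (K : Mat (suc m + suc m)) (sp : Big.Symplectic K) (fixes : col K zero ≗ e zero) where

    last-row : ∀ q → K (embed last) (embed q) ≡ does (q ≟ᴾ last)
    last-row q = begin
      K (embed last) (embed q)                   ≡⟨ Big.ω-eˡ zero (col K (embed q)) ⟨
      Big.ω (e zero) (col K (embed q))
        ≡⟨ Big.ω-cong {y = col K (embed q)} (λ a → sym (fixes a)) (λ _ → refl) ⟩
      Big.ω (col K zero) (col K (embed q))       ≡⟨ sp zero (embed q) ⟩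
      does (embed q ≟ embed last)                ≡⟨ embed-≟ q last ⟩
      does (q ≟ᴾ last)                           ∎
      where open ≡.≡-Reasoning

    first-row : ∀ j → K zero (ι j) ≡ Small.ω (col (proj₂ (proj₂ (restrict K))) j) (proj₁ (proj₂ (restrict K)))
    first-row j = xor≡false⇒≡ (begin
      K zero (ι j) xor Small.ω K′ⱼ f
        ≡⟨ cong₂ _xor_ (∧-identityʳ (K zero (ι j))) (xor-identityʳ (Small.ω K′ⱼ f)) ⟨
      (K zero (ι j) ∧ true) xor (Small.ω K′ⱼ f xor (false ∧ K zero (embed last)))
        ≡⟨ cong₂ (λ a b → (K zero (ι j) ∧ a) xor (Small.ω K′ⱼ f xor (b ∧ K zero (embed last))))
                 (last-row last) (last-row (middle j)) ⟨
      (K zero (ι j) ∧ K (embed last) (embed last)) xor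
      (Small.ω K′ⱼ f xor (K (embed last) (ι j) ∧ K zero (embed last)))
        ≡⟨ ω-parts (col K (ι j)) (col K (embed last)) ⟨
      Big.ω (col K (ι j)) (col K (embed last))
        ≡⟨ sp (ι j) (embed last) ⟩
      does (embed last ≟ σ (suc m) (ι j))
        ≡⟨ cong (λ c → does (embed last ≟ c)) (σ-embed (middle j)) ⟩
      does (embed last ≟ embed (middle (σ m j)))
        ≡⟨ embed-≟ last (middle (σ m j)) ⟩
      false ∎)
      where
      open ≡.≡-Reasoning
      K′ⱼ = λ k → K (ι k) (ι j)
      f = λ k → K (ι k) (embed last)

    restrict-extends : ∀ p q → block (restrict K) p q ≡ K (embed p) (embed q)
    restrict-extends p          first      = sym (trans (fixes (embed p)) (embed-≟ p first))
    restrict-extends first      (middle j) = sym (first-row j)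
    restrict-extends (middle k) (middle j) = refl
    restrict-extends last       (middle j) = sym (last-row (middle j))
    restrict-extends first      last       = refl
    restrict-extends (middle k) last       = refl
    restrict-extends last       last       = sym (last-row last)

  fixing : Mat (suc m + suc m) → ℤ
  fixing K = ℤΣ.when (Big.Spᵇ K ∧ (K ⊙ e zero Big.≈ᵛ e zero)) (+ 1)

  covers : ∀ K → fixing K ≡ + 0 ⊎ ∃ λ y → (∀ r c → extend y r c ≡ K r c)
  covers K with Big.symplectic? K | K ⊙ e zero Big.≈ᵛ? e zero
  ... | no ¬sp | _ =
    inj₁ (cong (λ b → ℤΣ.when (b ∧ (K ⊙ e zero Big.≈ᵛ e zero)) (+ 1)) (dec-false (Big.symplectic? K) ¬sp))
  ... | yes _  | no ¬fixes = inj₁ (cong (λ b → ℤΣ.when b (+ 1))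
    (trans (cong (Big.Spᵇ K ∧_) (dec-false (K ⊙ e zero Big.≈ᵛ? e zero) ¬fixes)) (∧-zeroʳ (Big.Spᵇ K))))
  ... | yes sp | yes fixes = inj₂ (restrict K , λ r c →
    subst₂ (λ r′ c′ → block (restrict K) (classify r) (classify c) ≡ K r′ c′) (embed-classify r) (embed-classify c)
      (restrict-extends K sp (λ a → trans (sym (⊙-e K zero a)) (fixes a)) (classify r) (classify c)))

  fixing-extend : ∀ y → fixing (extend y) ≡ ℤΣ.when (Small.Spᵇ (proj₂ (proj₂ y))) (+ 1)
  fixing-extend y = cong (λ b → ℤΣ.when b (+ 1)) (trans
    (cong₂ _∧_ (does-⇔ (extend-symplectic y) (Big.symplectic? (extend y)) (Small.symplectic? (proj₂ (proj₂ y))))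
               (dec-true (extend y ⊙ e zero Big.≈ᵛ? e zero) (λ a → trans (⊙-e (extend y) zero a) (extend-fixes-e₀ y a))))
    (∧-identityʳ _))

  stabilizer-size : Big.Orbit.fiber (e zero) (e zero) ≡ + 2 ℤ.* (+ (2 ^ (m + m)) ℤ.* Small.|Sp|)
  stabilizer-size = begin
    ℤΣ.∑ Big.matrices fixing
      ≡⟨ ℤΣ.∑-reindex Big.Mat-enumeration StabilizerData-enumeration extend
           (λ {K} {K′} K≈K′ → cong₂ (λ p q → ℤΣ.when (p ∧ q) (+ 1)) (Big.symplectic?-cong K≈K′)
                                  (Big.≈ᵛ-cong {y = e zero} (Big.⊙-cong {K} {K′} (e zero) K≈K′) (λ _ → refl)))
           (λ y≈y′ r c → block-cong y≈y′ (classify r) (classify c))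
           extend-injective covers ⟨
    ℤΣ.∑ (Enumeration.elements StabilizerData-enumeration) (fixing ∘ extend)
      ≡⟨ ℤΣ.∑-cong (Enumeration.elements StabilizerData-enumeration) fixing-extend ⟩
    ℤΣ.∑ (Enumeration.elements StabilizerData-enumeration) (λ y → ℤΣ.when (Small.Spᵇ (proj₂ (proj₂ y))) (+ 1))
      ≡⟨ ℤΣ.∑-pairs (false ∷ true ∷ []) (concatMap (λ f → map (f ,_) Small.matrices) Small.vectors)
                    (λ y → ℤΣ.when (Small.Spᵇ (proj₂ (proj₂ y))) (+ 1)) ⟩
    ℤΣ.∑ (false ∷ true ∷ []) (λ _ → ℤΣ.∑ (concatMap (λ f → map (f ,_) Small.matrices) Small.vectors)
                                       (λ p → ℤΣ.when (Small.Spᵇ (proj₂ p)) (+ 1)))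
      ≡⟨ ℤΣ.∑-const (false ∷ true ∷ []) _ ⟩
    + 2 ℤ.* ℤΣ.∑ (concatMap (λ f → map (f ,_) Small.matrices) Small.vectors) (λ p → ℤΣ.when (Small.Spᵇ (proj₂ p)) (+ 1))
      ≡⟨ cong (+ 2 ℤ.*_) (trans (ℤΣ.∑-pairs Small.vectors Small.matrices _) (∑-vectors-const (m + m) Small.|Sp|)) ⟩
    + 2 ℤ.* (+ (2 ^ (m + m)) ℤ.* Small.|Sp|) ∎
    where open ≡.≡-Reasoning

-- Counting

sgn : Bool → ℤ
sgn false = + 1
sgn true  = - (+ 1)

sgn-xor : ∀ a b → sgn (a xor b) ≡ sgn a ℤ.* sgn b
sgn-xor false false = refl
sgn-xor false true  = refl
sgn-xor true  false = refl
sgn-xor true  true  = refl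

-1^countTrue : ∀ {k} (xs : List (Fin k)) (v : Vector Bool k) →
  (- (+ 1)) ^ℤ foldr (λ i acc → if v i then suc acc else acc) 0 xs ≡ sgn (𝔽₂Σ.∑ xs v)
-1^countTrue []       v = refl
-1^countTrue (x ∷ xs) v with v x
... | true  = trans (cong (- (+ 1) ℤ.*_) (-1^countTrue xs v)) (sym (sgn-xor true (𝔽₂Σ.∑ xs v)))
... | false = -1^countTrue xs v

-1^o : ∀ {k} (K : Mat k) → (- (+ 1)) ^ℤ o K ≡ sgn (∑[ r < k ] (K ⊙ (λ _ → true)) r)
-1^o {k} K = trans (rows (allFin k)) (cong sgn (trans (∑-tabulate k (λ r → r) _)
  (sum-cong-≗ (λ r → trans (∑-tabulate k (λ c → c) (K r)) (sum-cong-≗ (λ c → sym (∧-identityʳ (K r c))))))))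
  where
  rows : ∀ xs →
    (- (+ 1)) ^ℤ foldr (λ i acc → countTrue (K i) + acc) 0 xs ≡ sgn (𝔽₂Σ.∑ xs (λ r → 𝔽₂Σ.∑ (allFin k) (K r)))
  rows []       = refl
  rows (r ∷ xs) = begin
    (- (+ 1)) ^ℤ (countTrue (K r) + rest)
      ≡⟨ ℤₚ.^-distribˡ-+-* (- (+ 1)) (countTrue (K r)) rest ⟩
    (- (+ 1)) ^ℤ countTrue (K r) ℤ.* (- (+ 1)) ^ℤ rest
      ≡⟨ cong₂ ℤ._*_ (-1^countTrue (allFin k) (K r)) (rows xs) ⟩
    sgn (𝔽₂Σ.∑ (allFin k) (K r)) ℤ.* sgn (𝔽₂Σ.∑ xs (λ r → 𝔽₂Σ.∑ (allFin k) (K r)))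
      ≡⟨ sgn-xor (𝔽₂Σ.∑ (allFin k) (K r)) (𝔽₂Σ.∑ xs (λ r → 𝔽₂Σ.∑ (allFin k) (K r))) ⟨
    sgn (𝔽₂Σ.∑ (allFin k) (K r) xor 𝔽₂Σ.∑ xs (λ r → 𝔽₂Σ.∑ (allFin k) (K r))) ∎
    where
    open ≡.≡-Reasoning
    rest = foldr (λ i acc → countTrue (K i) + acc) 0 xs

∑-neg : ∀ {A : Set} (xs : List A) (F : A → ℤ) → ℤΣ.∑ xs (λ x → - F x) ≡ - ℤΣ.∑ xs F
∑-neg []       F = refl
∑-neg (x ∷ xs) F = trans (cong (ℤ._+_ (- F x)) (∑-neg xs F)) (sym (ℤₚ.neg-distrib-+ (F x) _))

self-negative⇒0 : ∀ i → i ≡ - i → i ≡ + 0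
self-negative⇒0 (+ zero) _ = refl

∑-sgn-parity : ∀ k → ℤΣ.∑ (BoolVectors.vectors (suc k)) (λ v → sgn (sum v)) ≡ + 0
∑-sgn-parity k = self-negative⇒0 _ (begin
  ℤΣ.∑ vectors (λ v → sgn (sum v))
    ≡⟨ ℤΣ.∑-involution V-enumeration flip (λ v≗v′ → cong sgn (sum-cong-≗ v≗v′))
         (λ v≗v′ a → cong (_xor e zero a) (v≗v′ a)) (λ v a → flip-flip (v a) (e zero a)) ⟨
  ℤΣ.∑ vectors (λ v → sgn (sum (flip v)))
    ≡⟨ ℤΣ.∑-cong vectors flip-negates ⟩
  ℤΣ.∑ vectors (λ v → - sgn (sum v))
    ≡⟨ ∑-neg vectors (λ v → sgn (sum v)) ⟩
  - ℤΣ.∑ vectors (λ v → sgn (sum v)) ∎)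
  where
  open ≡.≡-Reasoning
  open BoolVectors (suc k)
  flip : Vector Bool (suc k) → Vector Bool (suc k)
  flip v a = v a xor e zero a
  flip-flip : ∀ a b → (a xor b) xor b ≡ a
  flip-flip a b = trans (xor-assoc a b b) (trans (cong (a xor_) (xor-same b)) (xor-identityʳ a))
  flip-negates : ∀ v → sgn (sum (flip v)) ≡ - sgn (sum v)
  flip-negates v = begin
    sgn (sum (flip v))                  ≡⟨ cong sgn (sum-distrib-xor v (e zero)) ⟩
    sgn (sum v xor sum (e {suc k} zero))
      ≡⟨ cong (λ b → sgn (sum v xor b)) (trans (sum-cong-≗ (λ a → sym (∧-identityʳ (e {suc k} zero a))))
                                                (sum-select {suc k} zero (λ _ → true))) ⟩
    sgn (sum v xor true)                ≡⟨ sgn-xor (sum v) true ⟩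
    sgn (sum v) ℤ.* - (+ 1)             ≡⟨ ℤₚ.*-comm (sgn (sum v)) (- (+ 1)) ⟩
    - (+ 1) ℤ.* sgn (sum v)             ≡⟨ ℤₚ.-1*i≡-i (sgn (sum v)) ⟩
    - sgn (sum v)                       ∎

∑-nonzero-sgn : ∀ k →
  ℤΣ.∑ (BoolVectors.vectors (suc k)) (λ v → ℤΣ.when (BoolVectors.nonzero (suc k) v) (sgn (sum v))) ≡ - (+ 1)
∑-nonzero-sgn k = ℤ+-cancelˡ (+ 1) _ _ (begin
  + 1 ℤ.+ ℤΣ.∑ vectors (λ v → ℤΣ.when (nonzero v) (sgn (sum v)))
    ≡⟨ cong (λ b → sgn b ℤ.+ ℤΣ.∑ vectors (λ v → ℤΣ.when (nonzero v) (sgn (sum v)))) (sum-zero {suc k} (λ _ → refl)) ⟨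
  sgn (sum 0ᵥ) ℤ.+ ℤΣ.∑ vectors (λ v → ℤΣ.when (nonzero v) (sgn (sum v)))
    ≡⟨ ∑-split-zero (λ v → sgn (sum v)) (λ v≗v′ → cong sgn (sum-cong-≗ v≗v′)) ⟨
  ℤΣ.∑ vectors (λ v → sgn (sum v))
    ≡⟨ ∑-sgn-parity k ⟩
  + 0 ∎)
  where
  open ≡.≡-Reasoning
  open BoolVectors (suc k)

sum-filter : ∀ {A : Set} {P : A → Set} (P? : ∀ x → Dec (P x)) (f : A → ℤ) (xs : List A) →
  sumℤ (map f (filter P? xs)) ≡ ℤΣ.∑ xs (λ x → ℤΣ.when (does (P? x)) (f x))
sum-filter P? f []       = refl
sum-filter P? f (x ∷ xs) with does (P? x)
... | true  = cong (ℤ._+_ (f x)) (sum-filter P? f xs)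
... | false = trans (sum-filter P? f xs) (sym (ℤₚ.+-identityˡ _))

2^suc∸1-nonZero : ∀ x → ℕ.NonZero (2 ^ suc x ∸ 1)
2^suc∸1-nonZero x = ℕ.>-nonZero (ℕₚ.m<n⇒0<n∸m (ℕₚ.*-monoʳ-≤ 2 (ℕₚ.m^n>0 2 x)))

2^square-suc : ∀ m b → + 2 ℤ.* (+ (2 ^ (m + m)) ℤ.* + (2 ^ (m * m) * b)) ≡ + (2 ^ (suc m * suc m) * b)
2^square-suc m b = begin
  + 2 ℤ.* (+ (2 ^ (m + m)) ℤ.* + (2 ^ (m * m) * b))
    ≡⟨ cong (+ 2 ℤ.*_) (ℤₚ.pos-* (2 ^ (m + m)) (2 ^ (m * m) * b)) ⟨
  + 2 ℤ.* + (2 ^ (m + m) * (2 ^ (m * m) * b))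
    ≡⟨ ℤₚ.pos-* 2 (2 ^ (m + m) * (2 ^ (m * m) * b)) ⟨
  + (2 * (2 ^ (m + m) * (2 ^ (m * m) * b)))
    ≡⟨ cong +_ (regroup (2 ^ (m + m)) (2 ^ (m * m)) b) ⟩
  + (2 * (2 ^ (m + m) * 2 ^ (m * m)) * b)
    ≡⟨ cong (λ k → + (2 * k * b)) (ℕₚ.^-distribˡ-+-* 2 (m + m) (m * m)) ⟨
  + (2 ^ suc ((m + m) + m * m) * b)
    ≡⟨ cong (λ k → + (2 ^ suc k * b)) (trans (ℕₚ.+-assoc m m (m * m)) (cong (_+_ m) (sym (ℕₚ.*-suc m m)))) ⟩
  + (2 ^ (suc m * suc m) * b) ∎
  where
  open ≡.≡-Reasoning
  regroup : ∀ a c b → 2 * (a * (c * b)) ≡ 2 * (a * c) * b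
  regroup = solve-∀

module SymplecticCount (m : ℕ) where
  open Symplectic (suc m)
  open Stabilizer m using (stabilizer-size)
  module Small = Symplectic m

  1ᵥ : V
  1ᵥ _ = true

  e₀-nonzero : nonzero (e zero) ≡ true
  e₀-nonzero = cong not (dec-false (e zero ≈ᵛ? 0ᵥ) (λ e₀≈0 → true≢false (e₀≈0 zero)))
    where
    true≢false : true ≢ false
    true≢false ()

  instance
    nonzero-count-nonZero : ℕ.NonZero (2 ^ N ∸ 1)
    nonzero-count-nonZero = 2^suc∸1-nonZero (m + suc m)

  |Sp|≡fiber*count : ∀ u → ∃ (λ a → u a ≡ true) → |Sp| ≡ Orbit.fiber u (e zero) ℤ.* + (2 ^ N ∸ 1)
  |Sp|≡fiber*count u u≢0 = trans (Orbit.∑-Sp≡fiber*∑-nonzero u u≢0 (e zero) e₀-nonzero (λ _ → + 1) (λ _ → refl))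
                                 (cong (Orbit.fiber u (e zero) ℤ.*_) count-nonzero)

  -- Both fibres have size |Sp| / (2 ^ N ∸ 1).
  fiber-1ᵥ≡fiber-e₀ : Orbit.fiber 1ᵥ (e zero) ≡ Orbit.fiber (e zero) (e zero)
  fiber-1ᵥ≡fiber-e₀ = ℤₚ.*-cancelʳ-≡ _ _ (+ (2 ^ N ∸ 1))
    (trans (sym (|Sp|≡fiber*count 1ᵥ (zero , refl))) (|Sp|≡fiber*count (e zero) (zero , refl)))

  |Sp|-recurrence : |Sp| ≡ (+ 2 ℤ.* (+ (2 ^ (m + m)) ℤ.* Small.|Sp|)) ℤ.* + (2 ^ N ∸ 1)
  |Sp|-recurrence = trans (|Sp|≡fiber*count (e zero) (zero , refl)) (cong (ℤ._* + (2 ^ N ∸ 1)) stabilizer-size)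

  signed-count :
    ℤΣ.∑ matrices (λ K → ℤΣ.when (Spᵇ K) ((- (+ 1)) ^ℤ o K)) ≡ - (+ 2 ℤ.* (+ (2 ^ (m + m)) ℤ.* Small.|Sp|))
  signed-count = begin
    ℤΣ.∑ matrices (λ K → ℤΣ.when (Spᵇ K) ((- (+ 1)) ^ℤ o K))
      ≡⟨ ℤΣ.∑-cong matrices (λ K → cong (ℤΣ.when (Spᵇ K)) (-1^o K)) ⟩
    ℤΣ.∑ matrices (λ K → ℤΣ.when (Spᵇ K) (sgn (sum (K ⊙ 1ᵥ))))
      ≡⟨ Orbit.∑-Sp≡fiber*∑-nonzero 1ᵥ (zero , refl) (e zero) e₀-nonzero (λ v → sgn (sum v))
                              (λ v≗v′ → cong sgn (sum-cong-≗ v≗v′)) ⟩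
    Orbit.fiber 1ᵥ (e zero) ℤ.* ℤΣ.∑ vectors (λ v → ℤΣ.when (nonzero v) (sgn (sum v)))
      ≡⟨ cong₂ ℤ._*_ (trans fiber-1ᵥ≡fiber-e₀ stabilizer-size) (∑-nonzero-sgn (m + suc m)) ⟩
    (+ 2 ℤ.* (+ (2 ^ (m + m)) ℤ.* Small.|Sp|)) ℤ.* - (+ 1)
      ≡⟨ ℤₚ.*-comm _ (- (+ 1)) ⟩
    - (+ 1) ℤ.* (+ 2 ℤ.* (+ (2 ^ (m + m)) ℤ.* Small.|Sp|))
      ≡⟨ ℤₚ.-1*i≡-i _ ⟩
    - (+ 2 ℤ.* (+ (2 ^ (m + m)) ℤ.* Small.|Sp|)) ∎
    where open ≡.≡-Reasoning

|Sp|-closed : ∀ m → Symplectic.|Sp| m ≡ + (2 ^ (m * m) * bracketProd m)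
|Sp|-closed zero    = refl
|Sp|-closed (suc m) = begin
  Symplectic.|Sp| (suc m)
    ≡⟨ SymplecticCount.|Sp|-recurrence m ⟩
  (+ 2 ℤ.* (+ (2 ^ (m + m)) ℤ.* Symplectic.|Sp| m)) ℤ.* + (2 ^ (suc m + suc m) ∸ 1)
    ≡⟨ cong (λ s → (+ 2 ℤ.* (+ (2 ^ (m + m)) ℤ.* s)) ℤ.* + (2 ^ (suc m + suc m) ∸ 1)) (|Sp|-closed m) ⟩
  (+ 2 ℤ.* (+ (2 ^ (m + m)) ℤ.* + (2 ^ (m * m) * bracketProd m))) ℤ.* + (2 ^ (suc m + suc m) ∸ 1)
    ≡⟨ cong (ℤ._* + (2 ^ (suc m + suc m) ∸ 1)) (2^square-suc m (bracketProd m)) ⟩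
  + (2 ^ (suc m * suc m) * bracketProd m) ℤ.* + (2 ^ (suc m + suc m) ∸ 1)
    ≡⟨ ℤₚ.pos-* (2 ^ (suc m * suc m) * bracketProd m) (2 ^ (suc m + suc m) ∸ 1) ⟨
  + (2 ^ (suc m * suc m) * bracketProd m * (2 ^ (suc m + suc m) ∸ 1))
    ≡⟨ cong +_ (ℕₚ.*-assoc (2 ^ (suc m * suc m)) (bracketProd m) _) ⟩
  + (2 ^ (suc m * suc m) * (bracketProd m * (2 ^ (suc m + suc m) ∸ 1)))
    ≡⟨ cong (λ k → + (2 ^ (suc m * suc m) * (bracketProd m * (2 ^ (suc m + k) ∸ 1)))) (ℕₚ.+-identityʳ (suc m)) ⟨
  + (2 ^ (suc m * suc m) * bracketProd (suc m)) ∎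
  where open ≡.≡-Reasoning

theorem4p1 : ∀ (n : ℕ) → n ≥ 1 →
    sumℤ (map (λ K → (- (+ 1)) ^ℤ o K) (Sp n))
      ≡ - (+ (2 ^ (n * n) * bracketProd (n ∸ 1)))
theorem4p1 (suc m) _ = begin
  sumℤ (map (λ K → (- (+ 1)) ^ℤ o K) (Sp (suc m)))
    ≡⟨ sum-filter (isSymplectic? (suc m)) (λ K → (- (+ 1)) ^ℤ o K) (allMats (suc m + suc m)) ⟩
  ℤΣ.∑ matrices (λ K → ℤΣ.when (does (isSymplectic? (suc m) K)) ((- (+ 1)) ^ℤ o K))
    ≡⟨ ℤΣ.∑-cong matrices (λ K → cong (λ b → ℤΣ.when b ((- (+ 1)) ^ℤ o K)) (does-isSymplectic? K)) ⟩
  ℤΣ.∑ matrices (λ K → ℤΣ.when (Spᵇ K) ((- (+ 1)) ^ℤ o K))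
    ≡⟨ signed-count ⟩
  - (+ 2 ℤ.* (+ (2 ^ (m + m)) ℤ.* Symplectic.|Sp| m))
    ≡⟨ cong (λ s → - (+ 2 ℤ.* (+ (2 ^ (m + m)) ℤ.* s))) (|Sp|-closed m) ⟩
  - (+ 2 ℤ.* (+ (2 ^ (m + m)) ℤ.* + (2 ^ (m * m) * bracketProd m)))
    ≡⟨ cong -_ (2^square-suc m (bracketProd m)) ⟩
  - (+ (2 ^ (suc m * suc m) * bracketProd m)) ∎
  where
  open ≡.≡-Reasoning
  open Symplectic (suc m)
  open SymplecticCount m using (signed-count)
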